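{- Let $\chi_{\mathrm{NM}}(k,\ell;n)$ denote the minimum number of colors sufficient to NM-color any set of $n$ trees, each with at most $\ell$ leaves, in a tree space with at most $k$ leaves, and let $\chi_{\mathrm{CF}}(k,\ell;n)$ denote the analogous minimum number of colors for CF-coloring. Then \begin{enumerate} \item $\chi_{\mathrm{NM}}(k,\ell;n) \leq \min\left(\ell+1,\, 2\sqrt{6k}\right)$; \item $\chi_{\mathrm{CF}}(k,\ell;n) = O(\ell \log k)$. \end{enumerate}
   Context: A network space is a 1-dimensional space with the topology of a graph (nodes are points, edges are simple curves between nodes, otherwise disjoint); a tree space is a network space whose topology is a tree, assumed to have no nodes of degree 2. The objects to be colored ("trees") are connected subsets of the tree space; each such object is itself a tree, and its leaves may lie in the interior of edges of the tree space. For a point $p$, let $S_p$ be the set of objects containing $p$. A coloring is non-monochromatic (NM) if for every point $p$ with $|S_p|\geq 2$, not all objects in $S_p$ have the same color. A coloring is conflict-free (CF) if for every point $p$ with $S_p$ non-empty, some object in $S_p$ has a color different from the colors of all other objects in $S_p$. The bounds do not depend on $n$ (the trivial bound $n$ also holds). -}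

module Defs where

open import Data.Nat using (ℕ; zero; suc; _≤_; _+_; _*_; _≤ᵇ_)
open import Data.Fin using (Fin; zero; suc; toℕ; _≟_)
open import Data.Bool using (Bool; true; false; _∧_; _∨_)
open import Data.Product using (Σ; _×_; ∃; ∃-syntax)
open import Relation.Binary.PropositionalEquality using (_≡_; _≢_)
open import Relation.Nullary.Decidable using (⌊_⌋)

-- A (subdivided) tree space, combinatorially: vertex set Fin (suc n),
-- vertex 0 is the root, vertex (suc i) has parent (parent i) of smaller index.
-- Every finite tree admits such a labelling.
record TreeSpace (n : ℕ) : Set where
  field
    parent  : Fin n → Fin (suc n)
    parent< : (i : Fin n) → toℕ (parent i) ≤ toℕ i
open TreeSpace public

Point : ℕ → Set
Point n = Fin (suc n)

Subset : ℕ → Set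
Subset n = Point n → Bool

full : ∀ {n} → Subset n
full _ = true

b2n : Bool → ℕ
b2n true  = 1
b2n false = 0

count : ∀ {m} → (Fin m → Bool) → ℕ
count {zero}  f = 0
count {suc m} f = b2n (f zero) + count {m} (λ i → f (suc i))

childOf : ∀ {n} → TreeSpace n → Point n → Point n → Bool
childOf T zero    v = false
childOf T (suc i) v = ⌊ parent T i ≟ v ⌋

adj : ∀ {n} → TreeSpace n → Point n → Point n → Bool
adj T u v = childOf T u v ∨ childOf T v u

degIn : ∀ {n} → TreeSpace n → Subset n → Point n → ℕ
degIn T S v = count (λ u → S u ∧ adj T u v)

leaves : ∀ {n} → TreeSpace n → Subset n → ℕ
leaves T S = count (λ v → S v ∧ (degIn T S v ≤ᵇ 1))

hostLeaves : ∀ {n} → TreeSpace n → ℕ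
hostLeaves T = leaves T full

data PathIn {n} (T : TreeSpace n) (S : Subset n) : Point n → Point n → Set where
  here : ∀ {u} → S u ≡ true → PathIn T S u u
  step : ∀ {u w v} → S u ≡ true → adj T u w ≡ true → PathIn T S w v → PathIn T S u v

-- S is a (nonempty) connected subset, i.e. a subtree
Connected : ∀ {n} → TreeSpace n → Subset n → Set
Connected T S = (∃[ v ] S v ≡ true) ×
                (∀ u v → S u ≡ true → S v ≡ true → PathIn T S u v)

ValidFamily : ∀ {n N} → TreeSpace n → ℕ → (Fin N → Subset n) → Set
ValidFamily T ℓ O = ∀ i → Connected T (O i) × leaves T (O i) ≤ ℓ

NM : ∀ {n N q} → (Fin N → Subset n) → (Fin N → Fin q) → Set
NM {n} {N} O c = ∀ (p : Point n) →
  (∃[ i ] ∃[ j ] (i ≢ j × O i p ≡ true × O j p ≡ true)) →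
  ∃[ i ] ∃[ j ] (O i p ≡ true × O j p ≡ true × c i ≢ c j)

CF : ∀ {n N q} → (Fin N → Subset n) → (Fin N → Fin q) → Set
CF {n} {N} O c = ∀ (p : Point n) →
  (∃[ i ] O i p ≡ true) →
  ∃[ i ] (O i p ≡ true × (∀ j → O j p ≡ true → j ≢ i → c j ≢ c i))

-- Order the trees by the depth of their top vertex.  Each tree A points, for each
-- of its bottom vertices a, to the earlier tree containing the top of A that reaches deepest towards
-- a.  Pointers go to earlier trees only and there are at most min(ℓ, k) of them per tree, so the
-- pointer graph is min(ℓ, k)-degenerate and greedily (min(ℓ, k) + 1)-colourable.  At a point covered
-- twice, the last tree there and the tree it points to towards the bottom vertex below the point
-- both contain the point, so they get different colours.
--
-- Call the root, the leaves and the branching vertices special; there are at most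
-- 2k of them.  Trees without special vertices have a single bottom vertex and take two colours by
-- the first bound.  Every other tree containing a non-special point p contains one of the two special
-- vertices bounding the segment of p, so four edges per special vertex (the two best trees entering
-- the segment from above, the two best from below, the best of each, and the two first trees at the
-- vertex itself) separate such trees at every point.  A graph with at most 8k edges is
-- δ-degenerate once (δ + 1)(δ + 2) > 16k, which leaves δ + 3 ≤ √(24k) colours in total.
--
-- In the heavy-path decomposition by leaf counts, every light edge halves the number of
-- leaves below, so a tree with ℓ leaves meets at most ℓ(1 + ⌈log₂ k⌉) heavy paths.  Cut each heavy
-- path greedily into segments whose witness, a tree containing the start of the segment and reaching
-- deepest along the path, covers the whole segment.  A tree meets at most two segments of each heavy
-- path, so joining every tree to the witnesses of the segments it meets gives out-degree
-- d = 2ℓ(1 + ⌈log₂ k⌉) and a 2d-degenerate graph; in a proper (2d + 1)-colouring every witness is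
-- uniquely coloured at its points.

module Submission where

open import Data.Nat
open import Data.Nat.Properties
open import Data.Nat.Logarithm using (⌈log₂_⌉; ⌈log₂⌉-mono-≤; ⌈log₂2^n⌉≡n; ⌈log₂2*n⌉≡1+⌈log₂n⌉)
open import Data.Nat.Tactic.RingSolver using (solve-∀)
open import Data.Fin as F using (Fin; zero; suc; toℕ; _↑ˡ_; _↑ʳ_)
open import Data.Fin.Properties using (toℕ-injective; toℕ<n; toℕ-↑ʳ; toℕ-↑ˡ)
  renaming (suc-injective to fsuc-injective)
open import Data.Bool using (Bool; true; false; _∧_; _∨_; not; if_then_else_)
open import Data.Bool.Properties using (T-≡; ∧-identityʳ; ∧-zeroʳ; ∧-comm; ∨-comm)
open import Algebra.Properties.CommutativeMonoid.Sum +-0-commutativeMonoid using (sum; sum-cong-≗; ∑-distrib-+)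
open import Data.List using (List; []; _∷_; length; _++_; map; concatMap)
open import Data.List.Properties using (length-map; length-++)
open import Data.Product using (∃; ∃-syntax; _×_; _,_; proj₁; proj₂)
open import Data.Sum using (_⊎_; inj₁; inj₂; [_,_]′)
open import Data.Empty using (⊥; ⊥-elim)
open import Function using (Equivalence)
open import Relation.Binary.PropositionalEquality
open import Relation.Binary.Definitions using (tri<; tri≈; tri>)
open import Relation.Nullary using (¬_; Dec; yes; no)
open import Relation.Nullary.Decidable using (⌊_⌋)
open import Defs

_==_ : ∀ {m} → Fin m → Fin m → Bool
i == j = ⌊ i F.≟ j ⌋

==⇒≡ : ∀ {m} {i j : Fin m} → (i == j) ≡ true → i ≡ j
==⇒≡ {i = i} {j} e with i F.≟ j
... | yes i≡j = i≡j

==-refl : ∀ {m} (i : Fin m) → (i == i) ≡ true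
==-refl i with i F.≟ i
... | yes _ = refl
... | no i≢i = ⊥-elim (i≢i refl)

≢⇒==-false : ∀ {m} {i j : Fin m} → i ≢ j → (i == j) ≡ false
≢⇒==-false {i = i} {j} i≢j with i F.≟ j
... | yes i≡j = ⊥-elim (i≢j i≡j)
... | no _ = refl

bool-absurd : ∀ {a} → a ≡ true → a ≡ false → ⊥
bool-absurd refl ()

bool-cases : (a : Bool) → a ≡ true ⊎ a ≡ false
bool-cases true = inj₁ refl
bool-cases false = inj₂ refl

==-false⇒≢ : ∀ {m} {i j : Fin m} → (i == j) ≡ false → i ≢ j
==-false⇒≢ {i = i} e refl = bool-absurd (==-refl i) e

suc-== : ∀ {m} (i j : Fin m) → (Fin.suc i == suc j) ≡ (i == j)
suc-== i j with i F.≟ j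
... | yes _ = refl
... | no _ = refl

∧-intro : ∀ {a b} → a ≡ true → b ≡ true → (a ∧ b) ≡ true
∧-intro refl refl = refl

∧-elimˡ : ∀ {a b} → (a ∧ b) ≡ true → a ≡ true
∧-elimˡ {true} _ = refl

∧-elimʳ : ∀ {a b} → (a ∧ b) ≡ true → b ≡ true
∧-elimʳ {true} e = e

∨-introˡ : ∀ {a b} → a ≡ true → (a ∨ b) ≡ true
∨-introˡ refl = refl

∨-introʳ : ∀ {a b} → b ≡ true → (a ∨ b) ≡ true
∨-introʳ {true} _ = refl
∨-introʳ {false} e = e

∨-elim : ∀ {a b} → (a ∨ b) ≡ true → a ≡ true ⊎ b ≡ true
∨-elim {true} _ = inj₁ refl
∨-elim {false} e = inj₂ e

not-true⇒false : ∀ {a} → not a ≡ true → a ≡ false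
not-true⇒false {false} _ = refl

false⇒not-true : ∀ {a} → a ≡ false → not a ≡ true
false⇒not-true refl = refl

≤ᵇ⇒≤′ : ∀ {m n} → (m ≤ᵇ n) ≡ true → m ≤ n
≤ᵇ⇒≤′ {m} {n} e = ≤ᵇ⇒≤ m n (Equivalence.from T-≡ e)

≤⇒≤ᵇ′ : ∀ {m n} → m ≤ n → (m ≤ᵇ n) ≡ true
≤⇒≤ᵇ′ m≤n = Equivalence.to T-≡ (≤⇒≤ᵇ m≤n)

<ᵇ⇒<′ : ∀ {m n} → (m <ᵇ n) ≡ true → m < n
<ᵇ⇒<′ {m} {n} e = <ᵇ⇒< m n (Equivalence.from T-≡ e)

<⇒<ᵇ′ : ∀ {m n} → m < n → (m <ᵇ n) ≡ true
<⇒<ᵇ′ m<n = Equivalence.to T-≡ (<⇒<ᵇ m<n)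

_without_ : ∀ {m} → (Fin m → Bool) → Fin m → Fin m → Bool
(f without x) i = f i ∧ not (i == x)

without-intro : ∀ {m} (f : Fin m → Bool) {x i} → f i ≡ true → i ≢ x → (f without x) i ≡ true
without-intro f fi i≢x = ∧-intro fi (false⇒not-true (≢⇒==-false i≢x))

without-≢ : ∀ {m} {f : Fin m → Bool} {x i} → (f without x) i ≡ true → i ≢ x
without-≢ {f = f} {i = i} e = ==-false⇒≢ (not-true⇒false (∧-elimʳ {f i} e))

anyᵇ : ∀ {m} → (Fin m → Bool) → Bool
anyᵇ {zero} f = false
anyᵇ {suc m} f = f zero ∨ anyᵇ (λ i → f (suc i))

anyᵇ-intro : ∀ {m} (f : Fin m → Bool) (i : Fin m) → f i ≡ true → anyᵇ f ≡ true
anyᵇ-intro f zero e = ∨-introˡ e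
anyᵇ-intro f (suc i) e = ∨-introʳ {f zero} (anyᵇ-intro (λ j → f (suc j)) i e)

anyᵇ-elim : ∀ {m} (f : Fin m → Bool) → anyᵇ f ≡ true → ∃ λ i → f i ≡ true
anyᵇ-elim {suc m} f e with ∨-elim {f zero} e
... | inj₁ f0 = zero , f0
... | inj₂ rest = let (i , fi) = anyᵇ-elim (λ j → f (suc j)) rest in suc i , fi

anyᵇ-false : ∀ {m} (f : Fin m → Bool) → anyᵇ f ≡ false → ∀ i → f i ≡ false
anyᵇ-false f e i with bool-cases (f i)
... | inj₂ fi = fi
... | inj₁ fi = ⊥-elim (bool-absurd (anyᵇ-intro f i fi) e)

find? : ∀ {m} (f : Fin m → Bool) → (∃ λ i → f i ≡ true) ⊎ (∀ i → f i ≡ false)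
find? f with bool-cases (anyᵇ f)
... | inj₁ e = inj₁ (anyᵇ-elim f e)
... | inj₂ e = inj₂ (anyᵇ-false f e)

count≤size : ∀ {m} (f : Fin m → Bool) → count f ≤ m
count≤size {zero} f = z≤n
count≤size {suc m} f with f zero
... | true = s≤s (count≤size (λ i → f (suc i)))
... | false = m≤n⇒m≤1+n (count≤size (λ i → f (suc i)))

count-mono : ∀ {m} (f g : Fin m → Bool) → (∀ i → f i ≡ true → g i ≡ true) → count f ≤ count g
count-mono {zero} f g f⊆g = z≤n
count-mono {suc m} f g f⊆g with f zero in ef | g zero in eg
... | true | true = s≤s (count-mono _ _ (λ i → f⊆g (suc i)))
... | true | false = ⊥-elim (bool-absurd (f⊆g zero ef) eg)
... | false | true = m≤n⇒m≤1+n (count-mono _ _ (λ i → f⊆g (suc i)))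
... | false | false = count-mono _ _ (λ i → f⊆g (suc i))

count-none : ∀ {m} (f : Fin m → Bool) → (∀ i → f i ≡ false) → count f ≡ 0
count-none {zero} f none = refl
count-none {suc m} f none rewrite none zero = count-none (λ i → f (suc i)) (λ i → none (suc i))

count-pos : ∀ {m} (f : Fin m → Bool) (i : Fin m) → f i ≡ true → 1 ≤ count f
count-pos f zero e rewrite e = s≤s z≤n
count-pos f (suc i) e = ≤-trans (count-pos (λ j → f (suc j)) i e) (m≤n+m _ (b2n (f zero)))

count-∨ : ∀ {m} (f g : Fin m → Bool) → count (λ i → f i ∨ g i) ≤ count f + count g
count-∨ {zero} f g = z≤n
count-∨ {suc m} f g with f zero | g zero
... | true | true = s≤s (≤-trans (count-∨ (λ i → f (suc i)) (λ i → g (suc i)))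
                                 (≤-trans (m≤n+m _ 1) (≤-reflexive (sym (+-suc _ _)))))
... | true | false = s≤s (count-∨ (λ i → f (suc i)) (λ i → g (suc i)))
... | false | true = ≤-trans (s≤s (count-∨ (λ i → f (suc i)) (λ i → g (suc i)))) (≤-reflexive (sym (+-suc _ _)))
... | false | false = count-∨ (λ i → f (suc i)) (λ i → g (suc i))

count-∨-disjoint : ∀ {m} (f g : Fin m → Bool) → (∀ i → f i ≡ true → g i ≡ true → ⊥) →
                   count f + count g ≤ count (λ i → f i ∨ g i)
count-∨-disjoint {zero} f g disj = z≤n
count-∨-disjoint {suc m} f g disj with f zero in ef | g zero in eg
... | true | true = ⊥-elim (disj zero ef eg)
... | true | false = s≤s (count-∨-disjoint _ _ (λ i → disj (suc i)))
... | false | true = ≤-trans (≤-reflexive (+-suc _ _)) (s≤s (count-∨-disjoint _ _ (λ i → disj (suc i))))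
... | false | false = count-∨-disjoint _ _ (λ i → disj (suc i))

count-unique≤1 : ∀ {m} (f : Fin m → Bool) → (∀ i j → f i ≡ true → f j ≡ true → i ≡ j) → count f ≤ 1
count-unique≤1 {zero} f unique = z≤n
count-unique≤1 {suc m} f unique with f zero in e
... | true = s≤s (≤-reflexive (count-none _ rest-false))
  where
  rest-false : ∀ i → f (suc i) ≡ false
  rest-false i with bool-cases (f (suc i))
  ... | inj₂ p = p
  ... | inj₁ p with unique zero (suc i) e p
  ... | ()
... | false = count-unique≤1 (λ i → f (suc i)) (λ i j p q → fsuc-injective (unique (suc i) (suc j) p q))

count-cong : ∀ {m} {f g : Fin m → Bool} → (∀ i → f i ≡ g i) → count f ≡ count g
count-cong f≗g = ≤-antisym (count-mono _ _ (λ i e → trans (sym (f≗g i)) e))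
                           (count-mono _ _ (λ i e → trans (f≗g i) e))

count-without : ∀ {m} (f : Fin m → Bool) (x : Fin m) → f x ≡ true → suc (count (f without x)) ≡ count f
count-without {suc m} f zero e rewrite e = cong suc (count-cong (λ i → ∧-identityʳ (f (suc i))))
count-without {suc m} f (suc x) e with f zero
... | true = cong suc (trans (cong suc (count-cong suc-without)) (count-without (λ i → f (suc i)) x e))
  where
  suc-without : ∀ i → (f without suc x) (suc i) ≡ ((λ j → f (suc j)) without x) i
  suc-without i = cong (λ b → f (suc i) ∧ not b) (suc-== i x)
... | false = trans (cong suc (count-cong suc-without)) (count-without (λ i → f (suc i)) x e)
  where
  suc-without : ∀ i → (f without suc x) (suc i) ≡ ((λ j → f (suc j)) without x) i
  suc-without i = cong (λ b → f (suc i) ∧ not b) (suc-== i x)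

count-two≤ : ∀ {m} (f : Fin m → Bool) i j → f i ≡ true → f j ≡ true → i ≢ j → 2 ≤ count f
count-two≤ f i j fi fj i≢j = ≤-trans (s≤s (count-pos (f without i) j (without-intro f fj (λ e → i≢j (sym e)))))
                                     (≤-reflexive (count-without f i fi))

count-injection : ∀ {m m'} (f : Fin m → Bool) (g : Fin m' → Bool) (h : Fin m → Fin m') →
                  (∀ i → f i ≡ true → g (h i) ≡ true) →
                  (∀ i j → f i ≡ true → f j ≡ true → h i ≡ h j → i ≡ j) →
                  count f ≤ count g
count-injection {zero} f g h maps inj = z≤n
count-injection {suc m} f g h maps inj with f zero in e
... | false = count-injection (λ i → f (suc i)) g (λ i → h (suc i)) (λ i → maps (suc i))
                (λ i j p q r → fsuc-injective (inj (suc i) (suc j) p q r))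
... | true = ≤-trans (s≤s (count-injection (λ i → f (suc i)) (g without h zero) (λ i → h (suc i)) maps′ inj′))
                     (≤-reflexive (count-without g (h zero) (maps zero e)))
  where
  maps′ : ∀ i → f (suc i) ≡ true → (g without h zero) (h (suc i)) ≡ true
  maps′ i p = without-intro g (maps (suc i) p) (λ q → 0≢1+n (sym (cong toℕ (inj (suc i) zero p e q))))
  inj′ : ∀ i j → f (suc i) ≡ true → f (suc j) ≡ true → h (suc i) ≡ h (suc j) → i ≡ j
  inj′ i j p q r = fsuc-injective (inj (suc i) (suc j) p q r)

count-image : ∀ {m m'} (P : Fin m → Bool) (h : Fin m → Fin m') →
              count (λ x → anyᵇ (λ i → P i ∧ (h i == x))) ≤ count P
count-image {zero} P h = ≤-reflexive (count-none (λ x → anyᵇ (λ i → P i ∧ (h i == x))) (λ x → refl))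
count-image {suc m} P h =
  ≤-trans (count-∨ (λ x → P zero ∧ (h zero == x)) (λ x → anyᵇ (λ i → P (suc i) ∧ (h (suc i) == x))))
          (+-mono-≤ (first (P zero)) (count-image (λ i → P (suc i)) (λ i → h (suc i))))
  where
  first : ∀ b → count (λ x → b ∧ (h zero == x)) ≤ b2n b
  first false = ≤-reflexive (count-none (λ x → false ∧ (h zero == x)) (λ x → refl))
  first true = count-unique≤1 (λ x → true ∧ (h zero == x)) (λ i j p q → trans (sym (==⇒≡ p)) (==⇒≡ q))

count<size⇒gap : ∀ {q} (used : Fin q → Bool) → count used < q → ∃ λ x → used x ≡ false
count<size⇒gap {q} used lt with find? (λ x → not (used x))
... | inj₁ (x , p) = x , not-true⇒false p
... | inj₂ none = ⊥-elim (<-irrefl refl (≤-<-trans all-used lt))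
  where
  all-used : q ≤ count used
  all-used = ≤-trans (≤-reflexive (sym (count-full q)))
                     (count-mono (λ _ → true) used (λ i _ → used-i i))
    where
    count-full : ∀ m → count {m} (λ _ → true) ≡ m
    count-full zero = refl
    count-full (suc m) = cong suc (count-full m)
    used-i : ∀ i → used i ≡ true
    used-i i with bool-cases (used i)
    ... | inj₁ p = p
    ... | inj₂ p = ⊥-elim (bool-absurd (false⇒not-true p) (none i))

record Best {m} (R : ℕ → ℕ → Set) (H : Fin m → Bool) (g : Fin m → ℕ) : Set where
  constructor best
  field
    elem : Fin m
    elem-∈ : H elem ≡ true
    elem-optimal : ∀ j → H j ≡ true → R (g elem) (g j)

module _ {R : ℕ → ℕ → Set} (R-total : ∀ x y → R x y ⊎ R y x)
         (R-trans : ∀ {x y z} → R x y → R y z → R x z) (R-refl : ∀ {x} → R x x) where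

  best? : ∀ {m} (H : Fin m → Bool) (g : Fin m → ℕ) → Best R H g ⊎ (∀ i → H i ≡ false)
  best? {zero} H g = inj₂ (λ ())
  best? {suc m} H g with best? (λ i → H (suc i)) (λ i → g (suc i)) | H zero in e
  ... | inj₂ none | false = inj₂ λ { zero → e ; (suc i) → none i }
  ... | inj₂ none | true =
        inj₁ (best zero e λ { zero _ → R-refl ; (suc j) p → ⊥-elim (bool-absurd p (none j)) })
  ... | inj₁ (best b b∈ b-opt) | false =
        inj₁ (best (suc b) b∈ λ { zero p → ⊥-elim (bool-absurd p e) ; (suc j) p → b-opt j p })
  ... | inj₁ (best b b∈ b-opt) | true with R-total (g zero) (g (suc b))
  ... | inj₁ z≺b = inj₁ (best zero e λ { zero _ → R-refl ; (suc j) p → R-trans z≺b (b-opt j p) })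
  ... | inj₂ b≺z = inj₁ (best (suc b) b∈ λ { zero _ → b≺z ; (suc j) p → b-opt j p })

  best-exists : ∀ {m} (H : Fin m → Bool) (g : Fin m → ℕ) (i : Fin m) → H i ≡ true → Best R H g
  best-exists H g i hi with best? H g
  ... | inj₁ b = b
  ... | inj₂ none = ⊥-elim (bool-absurd hi (none i))

ArgMax ArgMin : ∀ {m} → (Fin m → Bool) → (Fin m → ℕ) → Set
ArgMax = Best _≥_
ArgMin = Best _≤_

≥-total : ∀ x y → x ≥ y ⊎ y ≥ x
≥-total x y = ≤-total y x

≥-trans : ∀ {x y z} → x ≥ y → y ≥ z → x ≥ z
≥-trans x≥y y≥z = ≤-trans y≥z x≥y

opaque
  argmax? : ∀ {m} (H : Fin m → Bool) (g : Fin m → ℕ) → ArgMax H g ⊎ (∀ i → H i ≡ false)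
  argmax? = best? ≥-total ≥-trans ≤-refl

  argmin? : ∀ {m} (H : Fin m → Bool) (g : Fin m → ℕ) → ArgMin H g ⊎ (∀ i → H i ≡ false)
  argmin? = best? ≤-total ≤-trans ≤-refl

  argmax : ∀ {m} (H : Fin m → Bool) (g : Fin m → ℕ) (i : Fin m) → H i ≡ true → ArgMax H g
  argmax = best-exists ≥-total ≥-trans ≤-refl

  argmin : ∀ {m} (H : Fin m → Bool) (g : Fin m → ℕ) (i : Fin m) → H i ≡ true → ArgMin H g
  argmin = best-exists ≤-total ≤-trans ≤-refl

_∈ᵇ_ : ∀ {m} → Fin m → List (Fin m) → Bool
x ∈ᵇ [] = false
x ∈ᵇ (y ∷ ys) = (y == x) ∨ (x ∈ᵇ ys)

∈ᵇ-head : ∀ {m} (x : Fin m) xs → (x ∈ᵇ (x ∷ xs)) ≡ true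
∈ᵇ-head x xs = ∨-introˡ (==-refl x)

count-∈ᵇ≤length : ∀ {m} (xs : List (Fin m)) → count (λ x → x ∈ᵇ xs) ≤ length xs
count-∈ᵇ≤length {m} [] = ≤-reflexive (count-none {m} (λ x → x ∈ᵇ []) (λ x → refl))
count-∈ᵇ≤length (y ∷ ys) = ≤-trans (count-∨ (λ x → y == x) (λ x → x ∈ᵇ ys))
  (+-mono-≤ (count-unique≤1 (λ x → y == x) (λ i j p q → trans (sym (==⇒≡ p)) (==⇒≡ q)))
            (count-∈ᵇ≤length ys))

∈ᵇ-++⁺ˡ : ∀ {m} (x : Fin m) xs ys → (x ∈ᵇ xs) ≡ true → (x ∈ᵇ (xs ++ ys)) ≡ true
∈ᵇ-++⁺ˡ x (z ∷ zs) ys e with ∨-elim {z == x} e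
... | inj₁ p = ∨-introˡ p
... | inj₂ p = ∨-introʳ {z == x} (∈ᵇ-++⁺ˡ x zs ys p)

∈ᵇ-++⁺ʳ : ∀ {m} (x : Fin m) xs ys → (x ∈ᵇ ys) ≡ true → (x ∈ᵇ (xs ++ ys)) ≡ true
∈ᵇ-++⁺ʳ x [] ys e = e
∈ᵇ-++⁺ʳ x (z ∷ zs) ys e = ∨-introʳ {z == x} (∈ᵇ-++⁺ʳ x zs ys e)

∈ᵇ-++⁻ : ∀ {m} (x : Fin m) xs ys → (x ∈ᵇ (xs ++ ys)) ≡ true → (x ∈ᵇ xs) ≡ true ⊎ (x ∈ᵇ ys) ≡ true
∈ᵇ-++⁻ x [] ys e = inj₂ e
∈ᵇ-++⁻ x (z ∷ zs) ys e with ∨-elim {z == x} e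
... | inj₁ p = inj₁ (∨-introˡ p)
... | inj₂ p with ∈ᵇ-++⁻ x zs ys p
... | inj₁ q = inj₁ (∨-introʳ {z == x} q)
... | inj₂ q = inj₂ q

∈ᵇ-map-suc⁺ : ∀ {m} (x : Fin m) xs → (x ∈ᵇ xs) ≡ true → (Fin.suc x ∈ᵇ map suc xs) ≡ true
∈ᵇ-map-suc⁺ x (y ∷ ys) e with ∨-elim {y == x} e
... | inj₁ p = ∨-introˡ (trans (suc-== y x) p)
... | inj₂ p = ∨-introʳ {suc y == suc x} (∈ᵇ-map-suc⁺ x ys p)

∈ᵇ-map-suc⁻ : ∀ {m} (x : Fin m) xs → (Fin.suc x ∈ᵇ map suc xs) ≡ true → (x ∈ᵇ xs) ≡ true
∈ᵇ-map-suc⁻ x (y ∷ ys) e with ∨-elim {suc y == suc x} e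
... | inj₁ p = ∨-introˡ (trans (sym (suc-== y x)) p)
... | inj₂ p = ∨-introʳ {y == x} (∈ᵇ-map-suc⁻ x ys p)

zero∉map-suc : ∀ {m} (xs : List (Fin m)) → (Fin.zero ∈ᵇ map suc xs) ≡ false
zero∉map-suc [] = refl
zero∉map-suc (y ∷ ys) = zero∉map-suc ys

enumerate : ∀ {m} → (Fin m → Bool) → List (Fin m)
enumerate {zero} f = []
enumerate {suc m} f = (if f zero then zero ∷ [] else []) ++ map suc (enumerate (λ i → f (suc i)))

length-enumerate : ∀ {m} (f : Fin m → Bool) → length (enumerate f) ≡ count f
length-enumerate {zero} f = refl
length-enumerate {suc m} f with f zero
... | true = cong suc (trans (length-map suc (enumerate (λ i → f (suc i)))) (length-enumerate (λ i → f (suc i))))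
... | false = trans (length-map suc (enumerate (λ i → f (suc i)))) (length-enumerate (λ i → f (suc i)))

∈ᵇ-enumerate⁺ : ∀ {m} (f : Fin m → Bool) (x : Fin m) → f x ≡ true → (x ∈ᵇ enumerate f) ≡ true
∈ᵇ-enumerate⁺ {suc m} f zero e rewrite e = ∈ᵇ-head zero (map suc (enumerate (λ i → f (suc i))))
∈ᵇ-enumerate⁺ {suc m} f (suc x) e =
  ∈ᵇ-++⁺ʳ (suc x) (if f zero then zero ∷ [] else []) _
          (∈ᵇ-map-suc⁺ x (enumerate (λ i → f (suc i))) (∈ᵇ-enumerate⁺ (λ i → f (suc i)) x e))

∈ᵇ-enumerate⁻ : ∀ {m} (f : Fin m → Bool) (x : Fin m) → (x ∈ᵇ enumerate f) ≡ true → f x ≡ true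
∈ᵇ-enumerate⁻ {suc m} f x e
  with ∈ᵇ-++⁻ x (if f zero then zero ∷ [] else []) (map suc (enumerate (λ i → f (suc i)))) e
∈ᵇ-enumerate⁻ {suc m} f x e | inj₁ p with f zero in f0
... | true with ∨-elim {zero == x} p
... | inj₁ q rewrite sym (==⇒≡ q) = f0
∈ᵇ-enumerate⁻ {suc m} f zero e | inj₂ p =
  ⊥-elim (bool-absurd p (zero∉map-suc (enumerate (λ i → f (suc i)))))
∈ᵇ-enumerate⁻ {suc m} f (suc x) e | inj₂ p =
  ∈ᵇ-enumerate⁻ (λ i → f (suc i)) x (∈ᵇ-map-suc⁻ x (enumerate (λ i → f (suc i))) p)

∈ᵇ-concatMap⁺ : ∀ {m k} (g : Fin k → List (Fin m)) (xs : List (Fin k)) (x : Fin k) (y : Fin m) →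
                (x ∈ᵇ xs) ≡ true → (y ∈ᵇ g x) ≡ true → (y ∈ᵇ concatMap g xs) ≡ true
∈ᵇ-concatMap⁺ g (z ∷ zs) x y p q with ∨-elim {z == x} p
... | inj₁ r rewrite ==⇒≡ r = ∈ᵇ-++⁺ˡ y (g x) (concatMap g zs) q
... | inj₂ r = ∈ᵇ-++⁺ʳ y (g z) (concatMap g zs) (∈ᵇ-concatMap⁺ g zs x y r q)

∈ᵇ-concatMap⁻ : ∀ {m k} (g : Fin k → List (Fin m)) (xs : List (Fin k)) (y : Fin m) →
                (y ∈ᵇ concatMap g xs) ≡ true → ∃ λ x → (x ∈ᵇ xs) ≡ true × (y ∈ᵇ g x) ≡ true
∈ᵇ-concatMap⁻ g (z ∷ zs) y p with ∈ᵇ-++⁻ y (g z) (concatMap g zs) p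
... | inj₁ q = z , ∈ᵇ-head z zs , q
... | inj₂ q = let (x , r , s) = ∈ᵇ-concatMap⁻ g zs y q in x , ∨-introʳ {z == x} r , s

length-concatMap≤ : ∀ {A B : Set} (g : A → List B) (xs : List A) (d : ℕ) → (∀ x → length (g x) ≤ d) →
                    length (concatMap g xs) ≤ length xs * d
length-concatMap≤ g [] d bound = z≤n
length-concatMap≤ g (x ∷ xs) d bound =
  ≤-trans (≤-reflexive (length-++ (g x))) (+-mono-≤ (bound x) (length-concatMap≤ g xs d bound))

length-concatMap≤′ : ∀ {m} {B : Set} (g : Fin m → List B) (xs : List (Fin m)) (d : ℕ) →
                     (∀ x → (x ∈ᵇ xs) ≡ true → length (g x) ≤ d) → length (concatMap g xs) ≤ length xs * d
length-concatMap≤′ g [] d bound = z≤n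
length-concatMap≤′ g (x ∷ xs) d bound = ≤-trans (≤-reflexive (length-++ (g x)))
  (+-mono-≤ (bound x (∈ᵇ-head x xs)) (length-concatMap≤′ g xs d (λ y p → bound y (∨-introʳ {x == y} p))))

∈ᵇ-≡singleton : ∀ {m} {x : Fin m} {xs} → xs ≡ x ∷ [] → (x ∈ᵇ xs) ≡ true
∈ᵇ-≡singleton {x = x} refl = ∈ᵇ-head x []

module GreedyColouring {N : ℕ} (D : ℕ) (adj : Fin N → Fin N → Bool)
  (adj-sym : ∀ A B → adj A B ≡ true → adj B A ≡ true)
  (adj-irrefl : ∀ A → adj A A ≡ false)
  (degenerate : ∀ (H : Fin N → Bool) h → H h ≡ true →
                ∃ λ A → H A ≡ true × count (λ B → H B ∧ adj A B) ≤ D) where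

  Proper : (Fin N → Bool) → (Fin N → Fin (suc D)) → Set
  Proper H c = ∀ A B → H A ≡ true → H B ≡ true → adj A B ≡ true → c A ≢ c B

  recolour : (Fin N → Fin (suc D)) → Fin N → Fin (suc D) → Fin N → Fin (suc D)
  recolour c A x B = if B == A then x else c B

  recolour-≡ : ∀ c A x B → B ≡ A → recolour c A x B ≡ x
  recolour-≡ c A x .A refl rewrite ==-refl A = refl

  recolour-≢ : ∀ c A x B → B ≢ A → recolour c A x B ≡ c B
  recolour-≢ c A x B B≢A rewrite ≢⇒==-false B≢A = refl

  empty-proper : ∀ H → (∀ A → H A ≡ true → ⊥) → ∃ (Proper H)
  empty-proper H empty = (λ _ → zero) , λ A _ hA → ⊥-elim (empty A hA)

  extend : ∀ H A (c : Fin N → Fin (suc D)) → H A ≡ true → count (λ B → H B ∧ adj A B) ≤ D →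
           Proper (H without A) c → ∃ (Proper H)
  extend H A c hA dA proper = recolour c A x , proper′
    where
    neighbour : Fin N → Bool
    neighbour B = (H without A) B ∧ adj A B
    used : Fin (suc D) → Bool
    used y = anyᵇ (λ B → neighbour B ∧ (c B == y))
    few-used : count used < suc D
    few-used = s≤s (≤-trans (count-image neighbour c)
                   (≤-trans (count-mono neighbour (λ B → H B ∧ adj A B)
                     (λ B p → ∧-intro (∧-elimˡ {H B} (∧-elimˡ {(H without A) B} p)) (∧-elimʳ {(H without A) B} p))) dA))
    free = count<size⇒gap used few-used
    x = proj₁ free
    x-free : ∀ B → (H without A) B ≡ true → adj A B ≡ true → c B ≢ x
    x-free B hB aB cB≡x = bool-absurd (anyᵇ-intro (λ B → neighbour B ∧ (c B == x)) B
                                         (∧-intro (∧-intro hB aB) (subst (λ y → (c B == y) ≡ true) cB≡x (==-refl (c B)))))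
                                       (proj₂ free)
    proper′ : Proper H (recolour c A x)
    proper′ B B′ hB hB′ adjBB′ = by-cases (B F.≟ A) (B′ F.≟ A)
      where
      by-cases : Dec (B ≡ A) → Dec (B′ ≡ A) → recolour c A x B ≢ recolour c A x B′
      by-cases (yes B≡A) (yes B′≡A) _ =
        bool-absurd (subst₂ (λ u v → adj u v ≡ true) B≡A B′≡A adjBB′) (adj-irrefl A)
      by-cases (yes B≡A) (no B′≢A) eq =
        x-free B′ (without-intro H hB′ B′≢A) (subst (λ u → adj u B′ ≡ true) B≡A adjBB′)
               (trans (sym (recolour-≢ c A x B′ B′≢A)) (trans (sym eq) (recolour-≡ c A x B B≡A)))
      by-cases (no B≢A) (yes B′≡A) eq =
        x-free B (without-intro H hB B≢A) (adj-sym B A (subst (λ v → adj B v ≡ true) B′≡A adjBB′))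
               (trans (sym (recolour-≢ c A x B B≢A)) (trans eq (recolour-≡ c A x B′ B′≡A)))
      by-cases (no B≢A) (no B′≢A) eq =
        proper B B′ (without-intro H hB B≢A) (without-intro H hB′ B′≢A) adjBB′
               (trans (sym (recolour-≢ c A x B B≢A)) (trans eq (recolour-≢ c A x B′ B′≢A)))

  colour-subset : ∀ s (H : Fin N → Bool) → count H ≤ s → ∃ (Proper H)
  colour-subset zero H size = empty-proper H (λ A hA → n≮0 (≤-trans (count-pos H A hA) size))
  colour-subset (suc s) H size with find? H
  ... | inj₂ none = empty-proper H (λ A hA → bool-absurd hA (none A))
  ... | inj₁ (h , hh) with degenerate H h hh
  ... | A , hA , dA = let (c , proper) = colour-subset s (H without A) smaller in extend H A c hA dA proper
    where
    smaller : count (H without A) ≤ s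
    smaller = ≤-pred (≤-trans (≤-reflexive (count-without H A hA)) size)

  colouring : ∃ λ (c : Fin N → Fin (suc D)) → ∀ A B → adj A B ≡ true → c A ≢ c B
  colouring = let (c , proper) = colour-subset N (λ _ → true) (count≤size (λ _ → true)) in
              c , λ A B → proper A B refl refl

sum-mono : ∀ {m} {f g : Fin m → ℕ} → (∀ i → f i ≤ g i) → sum f ≤ sum g
sum-mono {zero} f≤g = z≤n
sum-mono {suc m} f≤g = +-mono-≤ (f≤g zero) (sum-mono (λ i → f≤g (suc i)))

sum-indicator : ∀ {m} (x : Fin m) (c : ℕ) → sum (λ i → if i == x then c else 0) ≡ c
sum-indicator {suc m} zero c = trans (cong (c +_) (sum-zeros m)) (+-identityʳ c)
  where
  sum-zeros : ∀ m → sum {m} (λ i → if Fin.suc i == zero then c else 0) ≡ 0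
  sum-zeros zero = refl
  sum-zeros (suc m) = sum-zeros m
sum-indicator {suc m} (suc x) c =
  trans (sum-cong-≗ (λ i → cong (λ b → if b then c else 0) (suc-== i x))) (sum-indicator x c)

sum-const-on : ∀ {m} (H : Fin m → Bool) (c : ℕ) → sum (λ i → if H i then c else 0) ≡ count H * c
sum-const-on {zero} H c = refl
sum-const-on {suc m} H c with H zero
... | true = cong (c +_) (sum-const-on (λ i → H (suc i)) c)
... | false = sum-const-on (λ i → H (suc i)) c

if-mono : ∀ (b : Bool) {x y} → x ≤ y → (if b then x else 0) ≤ (if b then y else 0)
if-mono true x≤y = x≤y
if-mono false x≤y = z≤n

count-at : ∀ {m} (H : Fin m → Bool) y → count (λ B → H B ∧ (B == y)) ≤ b2n (H y)
count-at H y with H y in hy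
... | true = count-unique≤1 (λ B → H B ∧ (B == y))
               (λ i j p q → trans (==⇒≡ (∧-elimʳ {H i} p)) (sym (==⇒≡ (∧-elimʳ {H j} q))))
... | false = ≤-reflexive (count-none (λ B → H B ∧ (B == y)) none)
  where
  none : ∀ B → (H B ∧ (B == y)) ≡ false
  none B with bool-cases (H B ∧ (B == y))
  ... | inj₂ p = p
  ... | inj₁ p = ⊥-elim (bool-absurd (subst (λ z → H z ≡ true) (==⇒≡ (∧-elimʳ {H B} p)) (∧-elimˡ {H B} p)) hy)

module EdgeGraph {N : ℕ} where

  Edge : Set
  Edge = Fin N × Fin N

  joins : Edge → Fin N → Fin N → Bool
  joins (x , y) A B = ((x == A) ∧ (y == B)) ∨ ((x == B) ∧ (y == A))

  hasEdge : List Edge → Fin N → Fin N → Bool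
  hasEdge [] A B = false
  hasEdge (e ∷ es) A B = joins e A B ∨ hasEdge es A B

  adjacent : List Edge → Fin N → Fin N → Bool
  adjacent es A B = not (A == B) ∧ hasEdge es A B

  joins-swap : ∀ x y A B → joins (x , y) A B ≡ joins (y , x) A B
  joins-swap x y A B = trans (cong₂ _∨_ (∧-comm (x == A) (y == B)) (∧-comm (x == B) (y == A)))
                             (∨-comm ((y == B) ∧ (x == A)) ((y == A) ∧ (x == B)))

  joins-sym : ∀ e A B → joins e A B ≡ true → joins e B A ≡ true
  joins-sym (x , y) A B p with ∨-elim {(x == A) ∧ (y == B)} p
  ... | inj₁ q = ∨-introʳ {(x == B) ∧ (y == A)} q
  ... | inj₂ q = ∨-introˡ q

  hasEdge-sym : ∀ es A B → hasEdge es A B ≡ true → hasEdge es B A ≡ true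
  hasEdge-sym (e ∷ es) A B p with ∨-elim {joins e A B} p
  ... | inj₁ q = ∨-introˡ (joins-sym e A B q)
  ... | inj₂ q = ∨-introʳ {joins e B A} (hasEdge-sym es A B q)

  adjacent-intro : ∀ es {A B} → A ≢ B → hasEdge es A B ≡ true → adjacent es A B ≡ true
  adjacent-intro es A≢B e = ∧-intro (false⇒not-true (≢⇒==-false A≢B)) e

  adjacent-≢ : ∀ es {A B} → adjacent es A B ≡ true → A ≢ B
  adjacent-≢ es {A} p = ==-false⇒≢ (not-true⇒false (∧-elimˡ {not (A == _)} p))

  adjacent-hasEdge : ∀ es {A B} → adjacent es A B ≡ true → hasEdge es A B ≡ true
  adjacent-hasEdge es {A} {B} p = ∧-elimʳ {not (A == B)} p

  adjacent-sym : ∀ es A B → adjacent es A B ≡ true → adjacent es B A ≡ true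
  adjacent-sym es A B p =
    adjacent-intro es (λ e → adjacent-≢ es p (sym e)) (hasEdge-sym es A B (adjacent-hasEdge es p))

  adjacent-irrefl : ∀ es A → adjacent es A A ≡ false
  adjacent-irrefl es A rewrite ==-refl A = refl

  hasEdge-singleton : ∀ x y → hasEdge ((x , y) ∷ []) x y ≡ true
  hasEdge-singleton x y = ∨-introˡ (∨-introˡ (∧-intro (==-refl x) (==-refl y)))

  module _ {R : ℕ → ℕ → Set} (R-total : ∀ x y → R x y ⊎ R y x)
           (R-trans : ∀ {x y z} → R x y → R y z → R x z) (R-refl : ∀ {x} → R x x) where

    bestTwo : (Fin N → Bool) → (Fin N → ℕ) → List Edge
    bestTwo H g with best? R-total R-trans R-refl H g
    ... | inj₂ _ = []
    ... | inj₁ r with best? R-total R-trans R-refl (H without Best.elem r) g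
    ...   | inj₂ _ = []
    ...   | inj₁ r₂ = (Best.elem r , Best.elem r₂) ∷ []

    bestTwo-length : ∀ H g → length (bestTwo H g) ≤ 1
    bestTwo-length H g with best? R-total R-trans R-refl H g
    ... | inj₂ _ = z≤n
    ... | inj₁ r with best? R-total R-trans R-refl (H without Best.elem r) g
    ...   | inj₂ _ = z≤n
    ...   | inj₁ r₂ = ≤-refl

    bestTwo-spec : ∀ H g i j → H i ≡ true → H j ≡ true → i ≢ j →
      ∃ λ x → ∃ λ y → hasEdge (bestTwo H g) x y ≡ true × H x ≡ true × H y ≡ true × x ≢ y ×
        (∀ k → H k ≡ true → R (g x) (g k)) × (∀ k → H k ≡ true → k ≢ x → R (g y) (g k))
    bestTwo-spec H g i j hi hj i≢j with best? R-total R-trans R-refl H g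
    ... | inj₂ none = ⊥-elim (bool-absurd hi (none i))
    ... | inj₁ (best x x∈ x-opt) with best? R-total R-trans R-refl (H without x) g
    ...   | inj₁ (best y y∈ y-opt) =
            x , y , hasEdge-singleton x y , x∈ , ∧-elimˡ {H y} y∈ , (λ e → without-≢ {f = H} y∈ (sym e)) , x-opt ,
            (λ k hk k≢x → y-opt k (without-intro H hk k≢x))
    ...   | inj₂ none with i F.≟ x
    ...     | yes i≡x = ⊥-elim (bool-absurd (without-intro H hj (λ j≡x → i≢j (trans i≡x (sym j≡x)))) (none j))
    ...     | no i≢x = ⊥-elim (bool-absurd (without-intro H hi i≢x) (none i))

  maxTwo minTwo : (Fin N → Bool) → (Fin N → ℕ) → List Edge
  maxTwo = bestTwo ≥-total ≥-trans ≤-refl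
  minTwo = bestTwo ≤-total ≤-trans ≤-refl

  mixedPair : (Fin N → Bool) → (Fin N → ℕ) → (Fin N → Bool) → (Fin N → ℕ) → List Edge
  mixedPair P g Q h with argmax? P g | argmin? Q h
  ... | inj₁ r | inj₁ r₂ = (Best.elem r , Best.elem r₂) ∷ []
  ... | _ | _ = []

  mixedPair-length : ∀ P g Q h → length (mixedPair P g Q h) ≤ 1
  mixedPair-length P g Q h with argmax? P g | argmin? Q h
  ... | inj₁ _ | inj₁ _ = ≤-refl
  ... | inj₁ _ | inj₂ _ = z≤n
  ... | inj₂ _ | _ = z≤n

  mixedPair-spec : ∀ P g Q h i j → P i ≡ true → Q j ≡ true →
    ∃ λ x → ∃ λ y → hasEdge (mixedPair P g Q h) x y ≡ true × P x ≡ true × Q y ≡ true ×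
      (∀ k → P k ≡ true → g k ≤ g x) × (∀ k → Q k ≡ true → h y ≤ h k)
  mixedPair-spec P g Q h i j pi qj with argmax? P g | argmin? Q h
  ... | inj₁ (best x x∈ x-max) | inj₁ (best y y∈ y-min) = x , y , hasEdge-singleton x y , x∈ , y∈ , x-max , y-min
  ... | inj₂ none | _ = ⊥-elim (bool-absurd pi (none i))
  ... | inj₁ _ | inj₂ none = ⊥-elim (bool-absurd qj (none j))

  hasEdge-++⁺ˡ : ∀ es₁ es₂ A B → hasEdge es₁ A B ≡ true → hasEdge (es₁ ++ es₂) A B ≡ true
  hasEdge-++⁺ˡ (e ∷ es₁) es₂ A B p with ∨-elim {joins e A B} p
  ... | inj₁ q = ∨-introˡ q
  ... | inj₂ q = ∨-introʳ {joins e A B} (hasEdge-++⁺ˡ es₁ es₂ A B q)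

  hasEdge-++⁺ʳ : ∀ es₁ es₂ A B → hasEdge es₂ A B ≡ true → hasEdge (es₁ ++ es₂) A B ≡ true
  hasEdge-++⁺ʳ [] es₂ A B p = p
  hasEdge-++⁺ʳ (e ∷ es₁) es₂ A B p = ∨-introʳ {joins e A B} (hasEdge-++⁺ʳ es₁ es₂ A B p)

  hasEdge-++⁻ : ∀ es₁ es₂ A B → hasEdge (es₁ ++ es₂) A B ≡ true → hasEdge es₁ A B ≡ true ⊎ hasEdge es₂ A B ≡ true
  hasEdge-++⁻ [] es₂ A B p = inj₂ p
  hasEdge-++⁻ (e ∷ es₁) es₂ A B p with ∨-elim {joins e A B} p
  ... | inj₁ q = inj₁ (∨-introˡ q)
  ... | inj₂ q with hasEdge-++⁻ es₁ es₂ A B q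
  ... | inj₁ r = inj₁ (∨-introʳ {joins e A B} r)
  ... | inj₂ r = inj₂ r

  hasEdge-concatMap⁺ : ∀ {m} (f : Fin m → List Edge) (xs : List (Fin m)) s A B →
                       (s ∈ᵇ xs) ≡ true → hasEdge (f s) A B ≡ true → hasEdge (concatMap f xs) A B ≡ true
  hasEdge-concatMap⁺ f (z ∷ zs) s A B p q with ∨-elim {z == s} p
  ... | inj₁ r rewrite ==⇒≡ r = hasEdge-++⁺ˡ (f s) (concatMap f zs) A B q
  ... | inj₂ r = hasEdge-++⁺ʳ (f z) (concatMap f zs) A B (hasEdge-concatMap⁺ f zs s A B r q)

  edgesWithin : (Fin N → Bool) → List Edge → ℕ
  edgesWithin H [] = 0
  edgesWithin H ((x , y) ∷ es) = b2n (H x ∧ H y) + edgesWithin H es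

  edgesWithin≤length : ∀ H es → edgesWithin H es ≤ length es
  edgesWithin≤length H [] = z≤n
  edgesWithin≤length H ((x , y) ∷ es) with H x ∧ H y
  ... | true = s≤s (edgesWithin≤length H es)
  ... | false = m≤n⇒m≤1+n (edgesWithin≤length H es)

  edgesWithin-++ : ∀ H es₁ es₂ → edgesWithin H (es₁ ++ es₂) ≡ edgesWithin H es₁ + edgesWithin H es₂
  edgesWithin-++ H [] es₂ = refl
  edgesWithin-++ H ((x , y) ∷ es₁) es₂ =
    trans (cong (b2n (H x ∧ H y) +_) (edgesWithin-++ H es₁ es₂)) (sym (+-assoc (b2n (H x ∧ H y)) _ _))

  degreeIn : List Edge → (Fin N → Bool) → Fin N → ℕ
  degreeIn es H A = count (λ B → H B ∧ adjacent es A B)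

  degreeIn-[] : ∀ H A → degreeIn [] H A ≡ 0
  degreeIn-[] H A = count-none (λ B → H B ∧ adjacent [] A B)
                      (λ B → trans (cong (H B ∧_) (∧-zeroʳ (not (A == B)))) (∧-zeroʳ (H B)))

  degreeIn<size : ∀ es H A → H A ≡ true → suc (degreeIn es H A) ≤ count H
  degreeIn<size es H A hA =
    ≤-trans (s≤s (count-mono (λ B → H B ∧ adjacent es A B) (H without A)
                   (λ B p → without-intro H (∧-elimˡ {H B} p) (λ e → adjacent-≢ es (∧-elimʳ {H B} p) (sym e)))))
            (≤-reflexive (count-without H A hA))

  edgeDegree : Edge → (Fin N → Bool) → Fin N → ℕ
  edgeDegree e H A = count (λ B → H B ∧ (not (A == B) ∧ joins e A B))

  degreeIn-∷ : ∀ e es H A → degreeIn (e ∷ es) H A ≤ edgeDegree e H A + degreeIn es H A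
  degreeIn-∷ e es H A =
    ≤-trans (count-mono (λ B → H B ∧ adjacent (e ∷ es) A B)
                        (λ B → (H B ∧ (not (A == B) ∧ joins e A B)) ∨ (H B ∧ adjacent es A B)) split)
            (count-∨ (λ B → H B ∧ (not (A == B) ∧ joins e A B)) (λ B → H B ∧ adjacent es A B))
    where
    split : ∀ B → (H B ∧ adjacent (e ∷ es) A B) ≡ true →
            ((H B ∧ (not (A == B) ∧ joins e A B)) ∨ (H B ∧ adjacent es A B)) ≡ true
    split B p with ∨-elim {joins e A B} (adjacent-hasEdge (e ∷ es) (∧-elimʳ {H B} p))
    ... | inj₁ q = ∨-introˡ (∧-intro (∧-elimˡ {H B} p) (∧-intro (∧-elimˡ {not (A == B)} (∧-elimʳ {H B} p)) q))
    ... | inj₂ q = ∨-introʳ {H B ∧ (not (A == B) ∧ joins e A B)}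
                     (∧-intro (∧-elimˡ {H B} p) (∧-intro (∧-elimˡ {not (A == B)} (∧-elimʳ {H B} p)) q))

  edgeDegree-swap : ∀ x y H A → edgeDegree (x , y) H A ≡ edgeDegree (y , x) H A
  edgeDegree-swap x y H A = count-cong (λ B → cong (λ b → H B ∧ (not (A == B) ∧ b)) (joins-swap x y A B))

  edgeDegree-off : ∀ x y H A → A ≢ x → A ≢ y → edgeDegree (x , y) H A ≡ 0
  edgeDegree-off x y H A A≢x A≢y = count-none _ none
    where
    none : ∀ B → (H B ∧ (not (A == B) ∧ joins (x , y) A B)) ≡ false
    none B with bool-cases (H B ∧ (not (A == B) ∧ joins (x , y) A B))
    ... | inj₂ q = q
    ... | inj₁ q with ∨-elim {(x == A) ∧ (y == B)} (∧-elimʳ {not (A == B)} (∧-elimʳ {H B} q))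
    ... | inj₁ r = ⊥-elim (A≢x (sym (==⇒≡ (∧-elimˡ {x == A} r))))
    ... | inj₂ r = ⊥-elim (A≢y (sym (==⇒≡ (∧-elimʳ {x == B} r))))

  edgeDegree-at-source : ∀ x y H → edgeDegree (x , y) H x ≤ b2n (H y)
  edgeDegree-at-source x y H = ≤-trans (count-mono _ (λ B → H B ∧ (B == y)) toward-y) (count-at H y)
    where
    toward-y : ∀ B → (H B ∧ (not (x == B) ∧ joins (x , y) x B)) ≡ true → (H B ∧ (B == y)) ≡ true
    toward-y B q with ∨-elim {(x == x) ∧ (y == B)} (∧-elimʳ {not (x == B)} (∧-elimʳ {H B} q))
    ... | inj₁ r = ∧-intro (∧-elimˡ {H B} q)
                           (subst (λ z → (z == y) ≡ true) (==⇒≡ (∧-elimʳ {x == x} r)) (==-refl y))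
    ... | inj₂ r = ⊥-elim (==-false⇒≢ (not-true⇒false (∧-elimˡ {not (x == B)} (∧-elimʳ {H B} q)))
                                      (==⇒≡ (∧-elimˡ {x == B} r)))

  edgeDegree-bound : ∀ x y H A → H A ≡ true →
    edgeDegree (x , y) H A ≤ (if A == x then b2n (H x ∧ H y) else 0) + (if A == y then b2n (H x ∧ H y) else 0)
  edgeDegree-bound x y H A hA with A F.≟ x
  ... | yes refl rewrite hA = ≤-trans (edgeDegree-at-source A y H) (m≤m+n _ _)
  ... | no A≢x with A F.≟ y
  ...   | yes refl rewrite hA = ≤-trans (≤-reflexive (edgeDegree-swap x A H A))
                                  (≤-trans (edgeDegree-at-source A x H) (≤-reflexive (cong b2n (sym (∧-identityʳ (H x))))))
  ...   | no A≢y = ≤-trans (≤-reflexive (edgeDegree-off x y H A A≢x A≢y)) z≤n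

  handshake : ∀ es H → sum (λ A → if H A then degreeIn es H A else 0) ≤ 2 * edgesWithin H es
  handshake [] H = ≤-trans (sum-mono (λ A → if-mono (H A) (≤-reflexive (degreeIn-[] H A))))
                           (≤-reflexive (trans (sum-const-on H 0) (*-zeroʳ (count H))))
  handshake ((x , y) ∷ es) H = begin
    sum (λ A → if H A then degreeIn ((x , y) ∷ es) H A else 0)  ≤⟨ sum-mono split ⟩
    sum (λ A → ends A + rest A)                                ≡⟨ ∑-distrib-+ ends rest ⟩
    sum ends + sum rest                                        ≤⟨ +-mono-≤ (≤-reflexive ends-sum) (handshake es H) ⟩
    (b + b) + 2 * edgesWithin H es                             ≡⟨ cong (_+ 2 * edgesWithin H es) (cong (b +_) (sym (+-identityʳ b))) ⟩
    2 * b + 2 * edgesWithin H es                               ≡⟨ sym (*-distribˡ-+ 2 b (edgesWithin H es)) ⟩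
    2 * edgesWithin H ((x , y) ∷ es)                           ∎
    where
    open ≤-Reasoning
    b = b2n (H x ∧ H y)
    ends rest : Fin N → ℕ
    ends A = (if A == x then b else 0) + (if A == y then b else 0)
    rest A = if H A then degreeIn es H A else 0
    split : ∀ A → (if H A then degreeIn ((x , y) ∷ es) H A else 0) ≤ ends A + rest A
    split A with H A in hA
    ... | false = z≤n
    ... | true = ≤-trans (degreeIn-∷ (x , y) es H A) (+-mono-≤ (edgeDegree-bound x y H A hA) ≤-refl)
    ends-sum : sum ends ≡ b + b
    ends-sum = trans (∑-distrib-+ (λ A → if A == x then b else 0) (λ A → if A == y then b else 0))
                     (cong₂ _+_ (sum-indicator x b) (sum-indicator y b))

  low-degree : ∀ es H h → H h ≡ true →
               ∃ λ A → H A ≡ true × count H * degreeIn es H A ≤ 2 * edgesWithin H es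
  low-degree es H h hh = A , A∈ , ≤-trans (≤-trans (≤-reflexive (sym (sum-const-on H (degreeIn es H A))))
                                                  (sum-mono pointwise))
                                         (handshake es H)
    where
    open Best (argmin H (degreeIn es H) h hh) renaming (elem to A; elem-∈ to A∈; elem-optimal to A-min)
    pointwise : ∀ B → (if H B then degreeIn es H A else 0) ≤ (if H B then degreeIn es H B else 0)
    pointwise B with H B in hB
    ... | true = A-min B hB
    ... | false = z≤n

  star : Fin N → List (Fin N) → List Edge
  star A ws = map (A ,_) ws

  hasEdge-star⁺ : ∀ A ws B → (B ∈ᵇ ws) ≡ true → hasEdge (star A ws) A B ≡ true
  hasEdge-star⁺ A (w ∷ ws) B p with ∨-elim {w == B} p
  ... | inj₁ q = ∨-introˡ (∨-introˡ (∧-intro (==-refl A) q))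
  ... | inj₂ q = ∨-introʳ {joins (A , w) A B} (hasEdge-star⁺ A ws B q)

  hasEdge-star⁻ : ∀ A ws u v → hasEdge (star A ws) u v ≡ true →
                  (A ≡ u × (v ∈ᵇ ws) ≡ true) ⊎ (A ≡ v × (u ∈ᵇ ws) ≡ true)
  hasEdge-star⁻ A (w ∷ ws) u v p with ∨-elim {joins (A , w) u v} p
  ... | inj₂ q with hasEdge-star⁻ A ws u v q
  ...   | inj₁ (e , r) = inj₁ (e , ∨-introʳ {w == v} r)
  ...   | inj₂ (e , r) = inj₂ (e , ∨-introʳ {w == u} r)
  hasEdge-star⁻ A (w ∷ ws) u v p | inj₁ q with ∨-elim {(A == u) ∧ (w == v)} q
  ... | inj₁ r = inj₁ (==⇒≡ (∧-elimˡ {A == u} r) , ∨-introˡ (∧-elimʳ {A == u} r))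
  ... | inj₂ r = inj₂ (==⇒≡ (∧-elimˡ {A == v} r) , ∨-introˡ (∧-elimʳ {A == v} r))

  edgesWithin-star : ∀ H A ws → edgesWithin H (star A ws) ≤ (if H A then length ws else 0)
  edgesWithin-star H A [] = z≤n
  edgesWithin-star H A (w ∷ ws) with H A in hA
  ... | true = +-mono-≤ (b2n≤1 (H w)) (≤-trans (edgesWithin-star H A ws) (≤-reflexive (cong (λ b → if b then length ws else 0) hA)))
    where
    b2n≤1 : ∀ b → b2n b ≤ 1
    b2n≤1 true = ≤-refl
    b2n≤1 false = z≤n
  ... | false = ≤-trans (edgesWithin-star H A ws) (≤-reflexive (cong (λ b → if b then length ws else 0) hA))

  concatAll : ∀ {m} → (Fin m → List Edge) → List Edge
  concatAll {zero} f = []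
  concatAll {suc m} f = f zero ++ concatAll (λ i → f (suc i))

  hasEdge-concatAll⁺ : ∀ {m} (f : Fin m → List Edge) A u v → hasEdge (f A) u v ≡ true → hasEdge (concatAll f) u v ≡ true
  hasEdge-concatAll⁺ f zero u v p = hasEdge-++⁺ˡ (f zero) _ u v p
  hasEdge-concatAll⁺ f (suc A) u v p = hasEdge-++⁺ʳ (f zero) _ u v (hasEdge-concatAll⁺ (λ i → f (suc i)) A u v p)

  hasEdge-concatAll⁻ : ∀ {m} (f : Fin m → List Edge) u v → hasEdge (concatAll f) u v ≡ true → ∃ λ A → hasEdge (f A) u v ≡ true
  hasEdge-concatAll⁻ {suc m} f u v p with hasEdge-++⁻ (f zero) (concatAll (λ i → f (suc i))) u v p
  ... | inj₁ q = zero , q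
  ... | inj₂ q = let (A , r) = hasEdge-concatAll⁻ (λ i → f (suc i)) u v q in suc A , r

  edgesWithin-concatAll : ∀ {m} H (f : Fin m → List Edge) → edgesWithin H (concatAll f) ≡ sum (λ A → edgesWithin H (f A))
  edgesWithin-concatAll {zero} H f = refl
  edgesWithin-concatAll {suc m} H f = trans (edgesWithin-++ H (f zero) (concatAll (λ i → f (suc i))))
                                            (cong (edgesWithin H (f zero) +_) (edgesWithin-concatAll H (λ i → f (suc i))))

  outGraph : (Fin N → List (Fin N)) → List Edge
  outGraph out = concatAll (λ A → star A (out A))

  hasEdge-outGraph⁺ : ∀ out A B → (B ∈ᵇ out A) ≡ true → hasEdge (outGraph out) A B ≡ true
  hasEdge-outGraph⁺ out A B p = hasEdge-concatAll⁺ (λ A → star A (out A)) A A B (hasEdge-star⁺ A (out A) B p)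

  hasEdge-outGraph⁻ : ∀ out u v → hasEdge (outGraph out) u v ≡ true → (v ∈ᵇ out u) ≡ true ⊎ (u ∈ᵇ out v) ≡ true
  hasEdge-outGraph⁻ out u v p with hasEdge-concatAll⁻ (λ A → star A (out A)) u v p
  ... | (A , q) with hasEdge-star⁻ A (out A) u v q
  ...   | inj₁ (refl , r) = inj₁ r
  ...   | inj₂ (refl , r) = inj₂ r

  edgesWithin-outGraph : ∀ out H d → (∀ A → length (out A) ≤ d) → edgesWithin H (outGraph out) ≤ count H * d
  edgesWithin-outGraph out H d bound =
    ≤-trans (≤-reflexive (edgesWithin-concatAll H (λ A → star A (out A))))
            (≤-trans (sum-mono (λ A → ≤-trans (edgesWithin-star H A (out A)) (if-mono (H A) (bound A))))
                     (≤-reflexive (sum-const-on H d)))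

module TwoPalettes {N m : ℕ} (F : Fin N → Bool) (c₀ : Fin N → Fin 2) (c₁ : Fin N → Fin (suc m)) where

  joint : Fin N → Fin (2 + suc m)
  joint A = if F A then 2 ↑ʳ c₁ A else c₀ A ↑ˡ suc m

  joint-true : ∀ A → F A ≡ true → toℕ (joint A) ≡ 2 + toℕ (c₁ A)
  joint-true A e rewrite e = toℕ-↑ʳ 2 (c₁ A)

  joint-false : ∀ A → F A ≡ false → toℕ (joint A) ≡ toℕ (c₀ A)
  joint-false A e rewrite e = toℕ-↑ˡ (c₀ A) (suc m)

  joint-≢₁ : ∀ A B → F A ≡ true → F B ≡ true → c₁ A ≢ c₁ B → joint A ≢ joint B
  joint-≢₁ A B fA fB ne q = ne (toℕ-injective (+-cancelˡ-≡ 2 (toℕ (c₁ A)) (toℕ (c₁ B))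
                               (trans (sym (joint-true A fA)) (trans (cong toℕ q) (joint-true B fB)))))

  joint-≢₀ : ∀ A B → F A ≡ false → F B ≡ false → c₀ A ≢ c₀ B → joint A ≢ joint B
  joint-≢₀ A B fA fB ne q = ne (toℕ-injective (trans (sym (joint-false A fA)) (trans (cong toℕ q) (joint-false B fB))))

  joint-≢₁₀ : ∀ A B → F A ≡ true → F B ≡ false → joint A ≢ joint B
  joint-≢₁₀ A B fA fB q = <-irrefl refl (<-≤-trans (subst (_< 2) (sym (joint-false B fB)) (toℕ<n (c₀ B)))
                             (≤-trans (m≤m+n 2 (toℕ (c₁ A))) (≤-reflexive (sym (trans (cong toℕ (sym q)) (joint-true A fA))))))

module RootedTree {n : ℕ} (Tr : TreeSpace n) where

  V : Set
  V = Point n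

  parentOf : V → V
  parentOf zero = zero
  parentOf (suc i) = parent Tr i

  parent<child : ∀ i → toℕ (parent Tr i) < toℕ (Fin.suc i)
  parent<child i = s≤s (parent< Tr i)

  index-induction : (P : V → Set) → (∀ v → (∀ w → toℕ w < toℕ v → P w) → P v) → ∀ v → P v
  index-induction P from-smaller v = go (suc (toℕ v)) v ≤-refl
    where
    go : ∀ k v → toℕ v < k → P v
    go (suc k) v lt = from-smaller v (λ w w<v → go k w (≤-trans w<v (≤-pred lt)))

  data Anc (u : V) : V → Set where
    anc-refl : Anc u u
    anc-step : ∀ i → Anc u (parent Tr i) → Anc u (suc i)

  anc⇒≤ : ∀ {u v} → Anc u v → toℕ u ≤ toℕ v
  anc⇒≤ anc-refl = ≤-refl
  anc⇒≤ (anc-step i p) = ≤-trans (anc⇒≤ p) (<⇒≤ (parent<child i))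

  anc-trans : ∀ {u v w} → Anc u v → Anc v w → Anc u w
  anc-trans p anc-refl = p
  anc-trans p (anc-step i q) = anc-step i (anc-trans p q)

  anc-≥⇒≡ : ∀ {u v} → Anc u v → toℕ v ≤ toℕ u → u ≡ v
  anc-≥⇒≡ anc-refl _ = refl
  anc-≥⇒≡ (anc-step i p) le = ⊥-elim (<-irrefl refl (<-≤-trans (≤-<-trans (anc⇒≤ p) (parent<child i)) le))

  anc-antisym : ∀ {u v} → Anc u v → Anc v u → u ≡ v
  anc-antisym p q = anc-≥⇒≡ p (anc⇒≤ q)

  anc-≢⇒< : ∀ {u v} → Anc u v → u ≢ v → toℕ u < toℕ v
  anc-≢⇒< uv u≢v = ≤∧≢⇒< (anc⇒≤ uv) (λ e → u≢v (toℕ-injective e))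

  anc-linear : ∀ {u v w} → Anc u w → Anc v w → Anc u v ⊎ Anc v u
  anc-linear anc-refl q = inj₂ q
  anc-linear (anc-step i p) anc-refl = inj₁ (anc-step i p)
  anc-linear (anc-step i p) (anc-step .i q) = anc-linear p q

  anc-linear-≤ : ∀ {u v w} → Anc u w → Anc v w → toℕ u ≤ toℕ v → Anc u v
  anc-linear-≤ p q u≤v with anc-linear p q
  ... | inj₁ r = r
  ... | inj₂ r with anc-≥⇒≡ r u≤v
  ...   | refl = anc-refl

  root-anc : ∀ v → Anc zero v
  root-anc = index-induction (Anc zero) from-smaller
    where
    from-smaller : ∀ v → (∀ w → toℕ w < toℕ v → Anc zero w) → Anc zero v
    from-smaller zero _ = anc-refl
    from-smaller (suc i) ih = anc-step i (ih (parent Tr i) (parent<child i))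

  anc-of-root : ∀ {u} → Anc u zero → u ≡ zero
  anc-of-root anc-refl = refl

  anc-parentOf : ∀ {u v} → Anc u v → u ≢ v → Anc u (parentOf v)
  anc-parentOf anc-refl u≢v = ⊥-elim (u≢v refl)
  anc-parentOf (anc-step i p) _ = p

  child-toward : ∀ {a b} → Anc a b → a ≢ b → ∃ λ i → parent Tr i ≡ a × Anc (suc i) b
  child-toward anc-refl a≢b = ⊥-elim (a≢b refl)
  child-toward {a} (anc-step i p) a≢b with a F.≟ parent Tr i
  ... | yes a≡pi = i , sym a≡pi , anc-refl
  ... | no a≢pi = let (j , pj , q) = child-toward p a≢pi in j , pj , anc-step i q

  no-vertex-between : ∀ {b x j} → Anc b x → Anc x (suc j) → parent Tr j ≡ b → x ≡ b ⊎ x ≡ suc j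
  no-vertex-between bx anc-refl e = inj₂ refl
  no-vertex-between bx (anc-step j q) refl = inj₁ (anc-antisym q bx)

  child-anc-sibling⇒≡ : ∀ {i j} → parent Tr i ≡ parent Tr j → Anc (suc i) (suc j) → i ≡ j
  child-anc-sibling⇒≡ {i} {j} e r with no-vertex-between (subst (λ z → Anc z (suc i)) e (anc-step i anc-refl)) r refl
  ... | inj₁ x = ⊥-elim (<-irrefl (cong toℕ (sym x)) (subst (λ z → toℕ z < suc (toℕ i)) e (parent<child i)))
  ... | inj₂ x = fsuc-injective x

  siblings-disjoint : ∀ {i j v} → parent Tr i ≡ parent Tr j → Anc (suc i) v → Anc (suc j) v → i ≡ j
  siblings-disjoint e p q with anc-linear p q
  ... | inj₁ r = child-anc-sibling⇒≡ e r
  ... | inj₂ r = sym (child-anc-sibling⇒≡ (sym e) r)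

  ancᵇ-fuel : ℕ → V → V → Bool
  ancᵇ-fuel zero u v = u == v
  ancᵇ-fuel (suc f) u zero = u == zero
  ancᵇ-fuel (suc f) u (suc i) = (u == suc i) ∨ ancᵇ-fuel f u (parent Tr i)

  ancᵇ : V → V → Bool
  ancᵇ u v = ancᵇ-fuel (toℕ v) u v

  ancᵇ-fuel-sound : ∀ f u v → ancᵇ-fuel f u v ≡ true → Anc u v
  ancᵇ-fuel-sound zero u v p rewrite ==⇒≡ p = anc-refl
  ancᵇ-fuel-sound (suc f) u zero p rewrite ==⇒≡ p = anc-refl
  ancᵇ-fuel-sound (suc f) u (suc i) p with ∨-elim {u == suc i} p
  ... | inj₁ q rewrite ==⇒≡ q = anc-refl
  ... | inj₂ q = anc-step i (ancᵇ-fuel-sound f u (parent Tr i) q)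

  ancᵇ-fuel-complete : ∀ f u v → Anc u v → toℕ v ≤ f → ancᵇ-fuel f u v ≡ true
  ancᵇ-fuel-complete zero u zero p le rewrite anc-of-root p = ==-refl (zero {n})
  ancᵇ-fuel-complete (suc f) u zero p le rewrite anc-of-root p = ==-refl (zero {n})
  ancᵇ-fuel-complete (suc f) u (suc i) anc-refl le = ∨-introˡ (==-refl (suc i))
  ancᵇ-fuel-complete (suc f) u (suc i) (anc-step .i p) le =
    ∨-introʳ {u == suc i} (ancᵇ-fuel-complete f u (parent Tr i) p (≤-pred (≤-trans (parent<child i) le)))

  ancᵇ-sound : ∀ {u v} → ancᵇ u v ≡ true → Anc u v
  ancᵇ-sound {u} {v} = ancᵇ-fuel-sound (toℕ v) u v

  ancᵇ-complete : ∀ {u v} → Anc u v → ancᵇ u v ≡ true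
  ancᵇ-complete {u} {v} p = ancᵇ-fuel-complete (toℕ v) u v p ≤-refl

  childOf⇒parent : ∀ {u v} → childOf Tr u v ≡ true → ∃ λ i → u ≡ suc i × parent Tr i ≡ v
  childOf⇒parent {suc i} p = i , refl , ==⇒≡ p

  childOf-parent : ∀ i → childOf Tr (suc i) (parent Tr i) ≡ true
  childOf-parent i = ==-refl (parent Tr i)

  childOf-unique : ∀ v u u′ → childOf Tr v u ≡ true → childOf Tr v u′ ≡ true → u ≡ u′
  childOf-unique v u u′ p q with childOf⇒parent {v} {u} p | childOf⇒parent {v} {u′} q
  ... | (i , refl , refl) | (.i , refl , refl) = refl

  pathIn-start : ∀ {S x y} → PathIn Tr S x y → S x ≡ true
  pathIn-start (here p) = p
  pathIn-start (step p _ _) = p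

  -- The only edge leaving the subtree of v joins v to its parent.
  path-exits-subtree : ∀ {S x y} v → PathIn Tr S x y → Anc v x → ¬ Anc v y → S (parentOf v) ≡ true
  path-exits-subtree v (here _) vx v∤y = ⊥-elim (v∤y vx)
  path-exits-subtree v (step {u = x} {w} sx xw path) vx v∤y with bool-cases (ancᵇ v w)
  ... | inj₁ vw = path-exits-subtree v path (ancᵇ-sound vw) v∤y
  ... | inj₂ v∤w with ∨-elim {childOf Tr x w} xw
  ...   | inj₁ x-child with childOf⇒parent {x} {w} x-child
  ...     | (i , refl , refl) with vx
  ...       | anc-refl = pathIn-start path
  ...       | anc-step .i p = ⊥-elim (bool-absurd (ancᵇ-complete p) v∤w)
  path-exits-subtree v (step {u = x} {w} sx xw path) vx v∤y | inj₂ v∤w | inj₂ w-child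
    with childOf⇒parent {w} {x} w-child
  ... | (j , refl , refl) = ⊥-elim (bool-absurd (ancᵇ-complete (anc-step j vx)) v∤w)

  hasChildIn : (V → Bool) → V → Bool
  hasChildIn S v = anyᵇ (λ u → S u ∧ childOf Tr u v)

  childlessIn : (V → Bool) → V → Bool
  childlessIn S v = S v ∧ not (hasChildIn S v)

  childlessInHost : V → Bool
  childlessInHost = childlessIn full

  childless⇒leaf : ∀ S v → childlessIn S v ≡ true → (S v ∧ (degIn Tr S v ≤ᵇ 1)) ≡ true
  childless⇒leaf S v p = ∧-intro (∧-elimˡ {S v} p)
    (≤⇒≤ᵇ′ (≤-trans (count-mono _ (λ u → childOf Tr v u) neighbour-is-parent) (count-unique≤1 _ (childOf-unique v))))
    where
    no-child : ∀ u → S u ≡ true → childOf Tr u v ≡ false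
    no-child u su with bool-cases (childOf Tr u v)
    ... | inj₂ e = e
    ... | inj₁ e = ⊥-elim (bool-absurd (anyᵇ-intro (λ u → S u ∧ childOf Tr u v) u (∧-intro su e))
                                       (not-true⇒false (∧-elimʳ {S v} p)))
    neighbour-is-parent : ∀ u → (S u ∧ adj Tr u v) ≡ true → childOf Tr v u ≡ true
    neighbour-is-parent u q with ∨-elim {childOf Tr u v} (∧-elimʳ {S u} q)
    ... | inj₁ r = ⊥-elim (bool-absurd r (no-child u (∧-elimˡ {S u} q)))
    ... | inj₂ r = r

  childless≤leaves : ∀ S → count (childlessIn S) ≤ leaves Tr S
  childless≤leaves S = count-mono _ _ (childless⇒leaf S)

  index-max⇒childless : ∀ S v → (∀ u → S u ≡ true → Anc v u → toℕ u ≤ toℕ v) → S v ≡ true →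
                        childlessIn S v ≡ true
  index-max⇒childless S v v-max sv = ∧-intro sv (false⇒not-true no-child)
    where
    no-child : hasChildIn S v ≡ false
    no-child with bool-cases (hasChildIn S v)
    ... | inj₂ e = e
    ... | inj₁ e with anyᵇ-elim (λ u → S u ∧ childOf Tr u v) e
    ...   | (u , q) with childOf⇒parent {u} {v} (∧-elimʳ {S u} q)
    ...     | (i , refl , refl) = ⊥-elim (<-irrefl refl (<-≤-trans (parent<child i)
                                   (v-max (suc i) (∧-elimˡ {S (suc i)} q) (anc-step i anc-refl))))

  module BottomBelow (S : V → Bool) (p : V) (sp : S p ≡ true) where

    open Best (argmax (λ u → S u ∧ ancᵇ p u) toℕ p (∧-intro sp (ancᵇ-complete {p} anc-refl)))
      renaming (elem to bottom; elem-∈ to bottom-∈; elem-optimal to bottom-max) public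

    bottom-in : S bottom ≡ true
    bottom-in = ∧-elimˡ {S bottom} bottom-∈

    bottom-anc : Anc p bottom
    bottom-anc = ancᵇ-sound (∧-elimʳ {S bottom} bottom-∈)

    bottom-childless : childlessIn S bottom ≡ true
    bottom-childless = index-max⇒childless S bottom
      (λ u su bu → bottom-max u (∧-intro su (ancᵇ-complete (anc-trans bottom-anc bu)))) bottom-in

  leafBelow : V → V
  leafBelow v = BottomBelow.bottom full v refl

  leafBelow-anc : ∀ v → Anc v (leafBelow v)
  leafBelow-anc v = BottomBelow.bottom-anc full v refl

  leafBelow-childless : ∀ v → childlessInHost (leafBelow v) ≡ true
  leafBelow-childless v = BottomBelow.bottom-childless full v refl

  leafBelow-max : ∀ v u → Anc v u → toℕ u ≤ toℕ (leafBelow v)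
  leafBelow-max v u vu = BottomBelow.bottom-max full v refl u (∧-intro refl (ancᵇ-complete vu))

  childlessInHost-pos : 1 ≤ count childlessInHost
  childlessInHost-pos = count-pos childlessInHost (leafBelow zero) (leafBelow-childless zero)

  childlessInHost≤hostLeaves : count childlessInHost ≤ hostLeaves Tr
  childlessInHost≤hostLeaves = childless≤leaves full

  childless-no-child : ∀ S {a} j → childlessIn S a ≡ true → parent Tr j ≡ a → S (suc j) ≡ true → ⊥
  childless-no-child S {a} j ca pj sj =
    bool-absurd (anyᵇ-intro (λ u → S u ∧ childOf Tr u a) (suc j)
                            (∧-intro sj (subst (λ z → childOf Tr (suc j) z ≡ true) pj (childOf-parent j))))
                (not-true⇒false (∧-elimʳ {S a} ca))

  module Subtree (S : V → Bool) (C : Connected Tr S) where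

    open Best (argmin S toℕ (proj₁ (proj₁ C)) (proj₂ (proj₁ C)))
      renaming (elem to top; elem-∈ to top-in; elem-optimal to top-min) public

    parentOf-in : ∀ v → S v ≡ true → v ≢ top → S (parentOf v) ≡ true
    parentOf-in v sv v≢top = path-exits-subtree v (proj₂ C v top sv top-in) anc-refl
                               (λ p → v≢top (anc-≥⇒≡ p (top-min v sv)))

    top-anc : ∀ v → S v ≡ true → Anc top v
    top-anc = index-induction (λ v → S v ≡ true → Anc top v) from-smaller
      where
      from-smaller : ∀ v → (∀ w → toℕ w < toℕ v → S w ≡ true → Anc top w) → S v ≡ true → Anc top v
      from-smaller v ih sv with v F.≟ top
      ... | yes refl = anc-refl
      ... | no v≢top with v
      ...   | zero = ⊥-elim (v≢top (toℕ-injective (sym (n≤0⇒n≡0 (top-min zero sv)))))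
      ...   | suc i = anc-step i (ih (parent Tr i) (parent<child i) (parentOf-in (suc i) sv v≢top))

    between-in : ∀ {x y} → Anc top x → Anc x y → S y ≡ true → S x ≡ true
    between-in tx anc-refl sy = sy
    between-in {x} tx (anc-step i p) sy with suc i F.≟ top
    ... | yes i≡top = subst (λ z → S z ≡ true) (sym (anc-antisym (subst (Anc x) i≡top (anc-step i p)) tx)) top-in
    ... | no i≢top = between-in tx p (parentOf-in (suc i) sy i≢top)

    between-in′ : ∀ {u x y} → S u ≡ true → Anc u x → Anc x y → S y ≡ true → S x ≡ true
    between-in′ su ux xy sy = between-in (anc-trans (top-anc _ su) ux) xy sy


    childless-antichain : ∀ a a′ → childlessIn S a ≡ true → childlessIn S a′ ≡ true → Anc a a′ → a ≡ a′
    childless-antichain a a′ ca ca′ aa′ with a F.≟ a′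
    ... | yes a≡a′ = a≡a′
    ... | no a≢a′ with child-toward aa′ a≢a′
    ...   | (j , pj , ja′) = ⊥-elim (childless-no-child S j ca pj
                               (between-in′ (∧-elimˡ {S a} ca) (subst (λ z → Anc z (suc j)) pj (anc-step j anc-refl))
                                            ja′ (∧-elimˡ {S a′} ca′)))

    childless≤childlessInHost : count (childlessIn S) ≤ count childlessInHost
    childless≤childlessInHost =
      count-injection (childlessIn S) childlessInHost leafBelow (λ i _ → leafBelow-childless i) injective
      where
      injective : ∀ i j → childlessIn S i ≡ true → childlessIn S j ≡ true → leafBelow i ≡ leafBelow j → i ≡ j
      injective i j ci cj e with anc-linear (leafBelow-anc i) (subst (Anc j) (sym e) (leafBelow-anc j))
      ... | inj₁ r = childless-antichain i j ci cj r
      ... | inj₂ r = sym (childless-antichain j i cj ci r)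

module Objects {n : ℕ} (Tr : TreeSpace n) {N : ℕ} (O : Fin N → Subset n)
               (CO : ∀ i → Connected Tr (O i)) where

  open RootedTree Tr

  top : Fin N → V
  top i = Subtree.top (O i) (CO i)

  top-in : ∀ i → O i (top i) ≡ true
  top-in i = Subtree.top-in (O i) (CO i)

  top-anc : ∀ i v → O i v ≡ true → Anc (top i) v
  top-anc i = Subtree.top-anc (O i) (CO i)

  between-in : ∀ i {x y} → Anc (top i) x → Anc x y → O i y ≡ true → O i x ≡ true
  between-in i = Subtree.between-in (O i) (CO i)

  between-in′ : ∀ i {u x y} → O i u ≡ true → Anc u x → Anc x y → O i y ≡ true → O i x ≡ true
  between-in′ i = Subtree.between-in′ (O i) (CO i)

  reach : Fin N → V → ℕ
  reach B a with argmax? (λ v → O B v ∧ ancᵇ v a) toℕ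
  ... | inj₁ r = toℕ (Best.elem r)
  ... | inj₂ _ = 0

  reach-spec : ∀ B a v → O B v ≡ true → Anc v a →
               ∃ λ r → O B r ≡ true × Anc r a × toℕ v ≤ toℕ r × reach B a ≡ toℕ r
  reach-spec B a v ov va with argmax? (λ v → O B v ∧ ancᵇ v a) toℕ
  ... | inj₁ (best r r∈ r-max) = r , ∧-elimˡ {O B r} r∈ , ancᵇ-sound (∧-elimʳ {O B r} r∈) ,
                                 r-max v (∧-intro ov (ancᵇ-complete va)) , refl
  ... | inj₂ none = ⊥-elim (bool-absurd (∧-intro ov (ancᵇ-complete va)) (none v))

  reach-≥ : ∀ B a v → O B v ≡ true → Anc v a → toℕ v ≤ reach B a
  reach-≥ B a v ov va = let (r , _ , _ , v≤r , eq) = reach-spec B a v ov va in ≤-trans v≤r (≤-reflexive (sym eq))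

  reach-covers : ∀ B {u p a} → O B u ≡ true → Anc u p → Anc p a → toℕ p ≤ reach B a → O B p ≡ true
  reach-covers B {u} {p} {a} ou up pa p≤reach =
    let (r , or , ra , _ , eq) = reach-spec B a u ou (anc-trans up pa) in
    between-in′ B ou up (anc-linear-≤ pa ra (≤-trans p≤reach (≤-reflexive eq))) or

lex-≤ : ∀ N a b x y → x < N → y < N → a * N + x < b * N + y → a ≤ b
lex-≤ N a b x y x<N y<N lt with a ≤? b
... | yes a≤b = a≤b
... | no a≰b = ⊥-elim (<-irrefl refl (<-≤-trans lt (≤-trans (below (≰⇒> a≰b)) (m≤m+n (a * N) x))))
  where
  below : b < a → b * N + y ≤ a * N
  below b<a = ≤-trans (<⇒≤ (+-monoʳ-< (b * N) y<N)) (≤-trans (≤-reflexive (+-comm (b * N) N)) (*-monoˡ-≤ N b<a))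

lex-< : ∀ N a b x y → x < N → a < b → a * N + x < b * N + y
lex-< N a b x y x<N a<b = <-≤-trans (+-monoʳ-< (a * N) x<N)
  (≤-trans (≤-reflexive (+-comm (a * N) N)) (≤-trans (*-monoˡ-≤ N a<b) (m≤m+n (b * N) y)))

lex-injective : ∀ N a b x y → x < N → y < N → a * N + x ≡ b * N + y → x ≡ y
lex-injective N a b x y x<N y<N eq with <-cmp a b
... | tri≈ _ refl _ = +-cancelˡ-≡ (a * N) x y eq
... | tri< a<b _ _ = ⊥-elim (<-irrefl eq (lex-< N a b x y x<N a<b))
... | tri> _ _ b<a = ⊥-elim (<-irrefl (sym eq) (lex-< N b a y x y<N b<a))

module LeafPointers {n : ℕ} (Tr : TreeSpace n) {N : ℕ} (O : Fin N → Subset n)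
                    (CO : ∀ i → Connected Tr (O i)) (Φ : Fin N → Bool) where

  open RootedTree Tr
  open Objects Tr O CO
  open EdgeGraph {N}

  -- Objects are ordered by the depth of their top vertex, ties broken by index.
  key : Fin N → ℕ
  key i = toℕ (top i) * N + toℕ i

  key<⇒top≤ : ∀ A B → key B < key A → toℕ (top B) ≤ toℕ (top A)
  key<⇒top≤ A B = lex-≤ N (toℕ (top B)) (toℕ (top A)) (toℕ B) (toℕ A) (toℕ<n B) (toℕ<n A)

  key-injective : ∀ A B → key A ≡ key B → A ≡ B
  key-injective A B e = toℕ-injective (lex-injective N (toℕ (top A)) (toℕ (top B)) (toℕ A) (toℕ B) (toℕ<n A) (toℕ<n B) e)

  candidate : Fin N → Fin N → Bool
  candidate A B = Φ B ∧ ((key B <ᵇ key A) ∧ O B (top A))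

  candidate-key : ∀ A B → candidate A B ≡ true → key B < key A
  candidate-key A B c = <ᵇ⇒<′ (∧-elimˡ {key B <ᵇ key A} (∧-elimʳ {Φ B} c))

  pointer : Fin N → V → List (Fin N)
  pointer A a with argmax? (candidate A) (λ B → reach B a)
  ... | inj₁ r = Best.elem r ∷ []
  ... | inj₂ _ = []

  pointer-length : ∀ A a → length (pointer A a) ≤ 1
  pointer-length A a with argmax? (candidate A) (λ B → reach B a)
  ... | inj₁ r = ≤-refl
  ... | inj₂ _ = z≤n

  pointer-candidate : ∀ A a M → (M ∈ᵇ pointer A a) ≡ true → candidate A M ≡ true
  pointer-candidate A a M p with argmax? (candidate A) (λ B → reach B a)
  ... | inj₁ (best r r∈ _) with ∨-elim {r == M} p
  ...   | inj₁ q = subst (λ z → candidate A z ≡ true) (==⇒≡ q) r∈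

  pointer-best : ∀ A a B → candidate A B ≡ true →
                 ∃ λ M → (M ∈ᵇ pointer A a) ≡ true × candidate A M ≡ true × reach B a ≤ reach M a
  pointer-best A a B cB with argmax? (candidate A) (λ B → reach B a)
  ... | inj₁ (best r r∈ r-max) = r , ∈ᵇ-head r [] , r∈ , r-max B cB
  ... | inj₂ none = ⊥-elim (bool-absurd cB (none B))

  pointers : Fin N → List (Fin N)
  pointers A = if Φ A then concatMap (pointer A) (enumerate (childlessIn (O A))) else []

  pointers-key : ∀ A B → (B ∈ᵇ pointers A) ≡ true → key B < key A
  pointers-key A B p with Φ A
  ... | true with ∈ᵇ-concatMap⁻ (pointer A) (enumerate (childlessIn (O A))) B p
  ...   | (a , _ , q) = candidate-key A B (pointer-candidate A a B q)

  pointers-length : ∀ A → length (pointers A) ≤ (if Φ A then count (childlessIn (O A)) else 0)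
  pointers-length A with Φ A
  ... | false = z≤n
  ... | true = ≤-trans (length-concatMap≤ (pointer A) (enumerate (childlessIn (O A))) 1 (pointer-length A))
                       (≤-reflexive (trans (*-identityʳ _) (length-enumerate (childlessIn (O A)))))

  pointers-intro : ∀ A a M → Φ A ≡ true → childlessIn (O A) a ≡ true → (M ∈ᵇ pointer A a) ≡ true →
                   (M ∈ᵇ pointers A) ≡ true
  pointers-intro A a M φA ca p rewrite φA =
    ∈ᵇ-concatMap⁺ (pointer A) (enumerate (childlessIn (O A))) a M (∈ᵇ-enumerate⁺ (childlessIn (O A)) a ca) p

  graph : List Edge
  graph = outGraph pointers

  lower-key-contains-top : ∀ A B p → key B < key A → O A p ≡ true → O B p ≡ true → O B (top A) ≡ true
  lower-key-contains-top A B p kB<kA oA oB =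
    between-in B (anc-linear-≤ (top-anc B p oB) (top-anc A p oA) (key<⇒top≤ A B kB<kA)) (top-anc A p oA) oB

  pointed-covers : ∀ A B p → Φ A ≡ true → O A p ≡ true → candidate A B ≡ true → O B p ≡ true →
                   ∃ λ M → Φ M ≡ true × O M p ≡ true × (M ∈ᵇ pointers A) ≡ true × key M < key A
  pointed-covers A B p φA oA cB oB =
    M , ∧-elimˡ {Φ M} cM , oM , pointers-intro A a M φA bottom-childless M∈ , candidate-key A M cM
    where
    open BottomBelow (O A) p oA renaming (bottom to a)
    M-spec = pointer-best A a B cB
    M = proj₁ M-spec
    M∈ = proj₁ (proj₂ M-spec)
    cM = proj₁ (proj₂ (proj₂ M-spec))
    oM : O M p ≡ true
    oM = reach-covers M (∧-elimʳ {key M <ᵇ key A} (∧-elimʳ {Φ M} cM)) (top-anc A p oA) bottom-anc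
           (≤-trans (reach-≥ B a p oB bottom-anc) (proj₂ (proj₂ (proj₂ M-spec))))

  shared-point-edge : ∀ p i j → i ≢ j → Φ i ≡ true → Φ j ≡ true → O i p ≡ true → O j p ≡ true →
    ∃ λ A → ∃ λ B → Φ A ≡ true × Φ B ≡ true × O A p ≡ true × O B p ≡ true × adjacent graph A B ≡ true
  shared-point-edge p i j i≢j φi φj oi oj =
    A , M , φA , φM , oA , oM , adjacent-intro graph (λ e → <-irrefl (cong key (sym e)) kM) (hasEdge-outGraph⁺ pointers A M M∈)
    where
    open Best (argmax (λ B → Φ B ∧ O B p) key i (∧-intro φi oi))
      renaming (elem to A; elem-∈ to A∈; elem-optimal to A-max)
    φA = ∧-elimˡ {Φ A} A∈
    oA = ∧-elimʳ {Φ A} A∈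
    other : ∃ λ B → (Φ B ∧ O B p) ≡ true × B ≢ A
    other with i F.≟ A
    ... | yes i≡A = j , ∧-intro φj oj , λ j≡A → i≢j (trans i≡A (sym j≡A))
    ... | no i≢A = i , ∧-intro φi oi , i≢A
    B = proj₁ other
    kB : key B < key A
    kB = ≤∧≢⇒< (A-max B (proj₁ (proj₂ other))) (λ e → proj₂ (proj₂ other) (key-injective B A e))
    cB : candidate A B ≡ true
    cB = ∧-intro (∧-elimˡ {Φ B} (proj₁ (proj₂ other)))
                 (∧-intro (<⇒<ᵇ′ kB) (lower-key-contains-top A B p kB oA (∧-elimʳ {Φ B} (proj₁ (proj₂ other)))))
    M-spec = pointed-covers A B p φA oA cB (∧-elimʳ {Φ B} (proj₁ (proj₂ other)))
    M = proj₁ M-spec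
    φM = proj₁ (proj₂ M-spec)
    oM = proj₁ (proj₂ (proj₂ M-spec))
    M∈ = proj₁ (proj₂ (proj₂ (proj₂ M-spec)))
    kM = proj₂ (proj₂ (proj₂ (proj₂ M-spec)))

  module Degenerate (D : ℕ) (few-leaves : ∀ A → Φ A ≡ true → count (childlessIn (O A)) ≤ D) where

    degenerate : ∀ (H : Fin N → Bool) h → H h ≡ true →
                 ∃ λ A → H A ≡ true × count (λ B → H B ∧ adjacent graph A B) ≤ D
    degenerate H h hh = A , A∈ , ≤-trans (count-mono _ (λ B → B ∈ᵇ pointers A) neighbour-pointed)
                                   (≤-trans (count-∈ᵇ≤length (pointers A)) (≤-trans (pointers-length A) (bound (Φ A) refl)))
      where
      open Best (argmax H key h hh) renaming (elem to A; elem-∈ to A∈; elem-optimal to A-max)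
      neighbour-pointed : ∀ B → (H B ∧ adjacent graph A B) ≡ true → (B ∈ᵇ pointers A) ≡ true
      neighbour-pointed B q with hasEdge-outGraph⁻ pointers A B (adjacent-hasEdge graph (∧-elimʳ {H B} q))
      ... | inj₁ r = r
      ... | inj₂ r = ⊥-elim (<-irrefl refl (<-≤-trans (pointers-key B A r) (A-max B (∧-elimˡ {H B} q))))
      bound : ∀ b → Φ A ≡ b → (if b then count (childlessIn (O A)) else 0) ≤ D
      bound true e = few-leaves A e
      bound false e = z≤n

    open GreedyColouring D (adjacent graph) (adjacent-sym graph) (adjacent-irrefl graph) degenerate

    nm-colouring : ∃ λ (c : Fin N → Fin (suc D)) →
      ∀ p i j → i ≢ j → Φ i ≡ true → Φ j ≡ true → O i p ≡ true → O j p ≡ true →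
      ∃ λ A → ∃ λ B → Φ A ≡ true × Φ B ≡ true × O A p ≡ true × O B p ≡ true × c A ≢ c B
    nm-colouring = proj₁ colouring , λ p i j i≢j φi φj oi oj →
      let (A , B , φA , φB , oA , oB , adjAB) = shared-point-edge p i j i≢j φi φj oi oj in
      A , B , φA , φB , oA , oB , proj₂ colouring A B adjAB

module SpecialVertices {n : ℕ} (Tr : TreeSpace n) where

  open RootedTree Tr

  branching : V → Bool
  branching v = 2 ≤ᵇ count (λ u → childOf Tr u v)

  special : V → Bool
  special v = ((v == zero) ∨ childlessInHost v) ∨ branching v

  root-special : special zero ≡ true
  root-special = ∨-introˡ {b = branching zero} (∨-introˡ {b = childlessInHost zero} (==-refl (zero {n})))

  childless-special : ∀ v → childlessInHost v ≡ true → special v ≡ true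
  childless-special v c = ∨-introˡ (∨-introʳ {v == zero} c)

  two-children-branching : ∀ v i j → parent Tr i ≡ v → parent Tr j ≡ v → i ≢ j → branching v ≡ true
  two-children-branching v i j pi pj i≢j = ≤⇒≤ᵇ′ (count-two≤ (λ u → childOf Tr u v) (suc i) (suc j)
    (subst (λ z → childOf Tr (suc i) z ≡ true) pi (childOf-parent i))
    (subst (λ z → childOf Tr (suc j) z ≡ true) pj (childOf-parent j))
    (λ e → i≢j (fsuc-injective e)))

  nonspecial≢root : ∀ v → special v ≡ false → v ≢ zero
  nonspecial≢root v ns refl = bool-absurd root-special ns

  fork-special : ∀ a a′ → ¬ Anc a a′ → ¬ Anc a′ a →
    ∃ λ m → Anc m a × Anc m a′ × special m ≡ true × (∀ v → Anc v a → Anc v a′ → toℕ v ≤ toℕ m)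
  fork-special a a′ a∤a′ a′∤a =
    m , ma , ma′ , ∨-introʳ {(m == zero) ∨ childlessInHost m} (two-children-branching m i i′ pi pi′ i≢i′) ,
    λ v va va′ → m-max v (∧-intro (ancᵇ-complete va) (ancᵇ-complete va′))
    where
    open Best (argmax (λ v → ancᵇ v a ∧ ancᵇ v a′) toℕ zero
                      (∧-intro (ancᵇ-complete (root-anc a)) (ancᵇ-complete (root-anc a′))))
      renaming (elem to m; elem-∈ to m∈; elem-optimal to m-max)
    ma = ancᵇ-sound (∧-elimˡ {ancᵇ m a} m∈)
    ma′ = ancᵇ-sound (∧-elimʳ {ancᵇ m a} m∈)
    toward-a = child-toward ma (λ e → a∤a′ (subst (λ z → Anc z a′) e ma′))
    toward-a′ = child-toward ma′ (λ e → a′∤a (subst (λ z → Anc z a) e ma))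
    i = proj₁ toward-a
    i′ = proj₁ toward-a′
    pi = proj₁ (proj₂ toward-a)
    pi′ = proj₁ (proj₂ toward-a′)
    i≢i′ : i ≢ i′
    i≢i′ e = <-irrefl refl (<-≤-trans (subst (λ z → toℕ z < suc (toℕ i)) pi (parent<child i))
               (m-max (suc i) (∧-intro (ancᵇ-complete (proj₂ (proj₂ toward-a)))
                 (ancᵇ-complete (subst (λ z → Anc (suc z) a′) (sym e) (proj₂ (proj₂ toward-a′)))))))

  leafBelow-mono : ∀ {u v} → Anc u v → toℕ (leafBelow v) ≤ toℕ (leafBelow u)
  leafBelow-mono {u} {v} uv = leafBelow-max u (leafBelow v) (anc-trans uv (leafBelow-anc v))

  side-child : ∀ b → branching b ≡ true → ∃ λ i → parent Tr i ≡ b × leafBelow (suc i) ≢ leafBelow b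
  side-child b br with find? (λ c → childOf Tr c b ∧ not (leafBelow c == leafBelow b))
  ... | inj₁ (c , q) with childOf⇒parent {c} {b} (∧-elimˡ {childOf Tr c b} q)
  ...   | (i , refl , pi) = i , pi , ==-false⇒≢ (not-true⇒false (∧-elimʳ {childOf Tr c b} q))
  side-child b br | inj₂ none = ⊥-elim (<-irrefl refl (<-≤-trans (s≤s (count-unique≤1 _ one-child)) (≤ᵇ⇒≤′ br)))
    where
    same-leaf : ∀ c → childOf Tr c b ≡ true → leafBelow c ≡ leafBelow b
    same-leaf c h with bool-cases (leafBelow c == leafBelow b)
    ... | inj₁ r = ==⇒≡ r
    ... | inj₂ r = ⊥-elim (bool-absurd (∧-intro h (false⇒not-true r)) (none c))
    one-child : ∀ u u′ → childOf Tr u b ≡ true → childOf Tr u′ b ≡ true → u ≡ u′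
    one-child u u′ p q with childOf⇒parent {u} {b} p | childOf⇒parent {u′} {b} q
    ... | (i , refl , pi) | (j , refl , pj) =
      cong suc (siblings-disjoint (trans pi (sym pj)) (leafBelow-anc (suc i))
                 (subst (Anc (suc j)) (trans (same-leaf (suc j) q) (sym (same-leaf (suc i) p))) (leafBelow-anc (suc j))))

  sideLeaf : V → V
  sideLeaf b with bool-cases (branching b)
  ... | inj₁ br = leafBelow (suc (proj₁ (side-child b br)))
  ... | inj₂ _ = zero

  sideLeaf-spec : ∀ b → branching b ≡ true →
                  ∃ λ i → parent Tr i ≡ b × leafBelow (suc i) ≢ leafBelow b × sideLeaf b ≡ leafBelow (suc i)
  sideLeaf-spec b br with bool-cases (branching b)
  ... | inj₁ br′ = let (i , pi , ne) = side-child b br′ in i , pi , ne , refl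
  ... | inj₂ nb = ⊥-elim (bool-absurd br nb)

  side-leaves-differ : ∀ {b b′ i j} → Anc b b′ → b ≢ b′ → parent Tr i ≡ b → parent Tr j ≡ b′ →
                       leafBelow (suc j) ≢ leafBelow b′ → leafBelow (suc i) ≢ leafBelow (suc j)
  side-leaves-differ {b} {b′} {i} {j} bb′ b≢b′ refl refl side e = side (toℕ-injective (≤-antisym
    (leafBelow-mono (anc-step j anc-refl))
    (≤-trans (leafBelow-mono i-above-b′) (≤-reflexive (cong toℕ e)))))
    where
    i-above-b′ : Anc (suc i) b′
    i-above-b′ with anc-linear (subst (Anc (suc i)) e (leafBelow-anc (suc i)))
                               (anc-trans (anc-step j anc-refl) (leafBelow-anc (suc j)))
    ... | inj₁ r = r
    ... | inj₂ r with no-vertex-between bb′ r refl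
    ...   | inj₁ x = ⊥-elim (b≢b′ (sym x))
    ...   | inj₂ x = subst (Anc (suc i)) (sym x) anc-refl

  branching<childless : suc (count branching) ≤ count childlessInHost
  branching<childless =
    ≤-trans (s≤s (count-injection branching (childlessInHost without leafBelow zero) sideLeaf hits injective))
            (≤-reflexive (count-without childlessInHost (leafBelow zero) (leafBelow-childless zero)))
    where
    hits : ∀ b → branching b ≡ true → (childlessInHost without leafBelow zero) (sideLeaf b) ≡ true
    hits b br with sideLeaf-spec b br
    ... | (i , refl , side , eq) rewrite eq = without-intro childlessInHost (leafBelow-childless (suc i)) not-root-leaf
      where
      not-root-leaf : leafBelow (suc i) ≢ leafBelow zero
      not-root-leaf e = side (toℕ-injective (≤-antisym (leafBelow-mono (anc-step i anc-refl))
                          (≤-trans (leafBelow-mono (root-anc (parent Tr i))) (≤-reflexive (cong toℕ (sym e))))))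
    injective : ∀ b b′ → branching b ≡ true → branching b′ ≡ true → sideLeaf b ≡ sideLeaf b′ → b ≡ b′
    injective b b′ br br′ e with sideLeaf-spec b br | sideLeaf-spec b′ br′ | b F.≟ b′
    ... | _ | _ | yes b≡b′ = b≡b′
    ... | (i , pi , side , eq) | (j , pj , side′ , eq′) | no b≢b′
      with anc-linear (anc-trans (subst (λ z → Anc z (suc i)) pi (anc-step i anc-refl)) (leafBelow-anc (suc i)))
                      (subst (Anc b′) (trans (sym eq′) (trans (sym e) eq))
                             (anc-trans (subst (λ z → Anc z (suc j)) pj (anc-step j anc-refl)) (leafBelow-anc (suc j))))
    ...   | inj₁ r = ⊥-elim (side-leaves-differ r b≢b′ pi pj side′ (trans (sym eq) (trans e eq′)))
    ...   | inj₂ r = ⊥-elim (side-leaves-differ r (λ x → b≢b′ (sym x)) pj pi side (trans (sym eq′) (trans (sym e) eq)))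

  special≤2*childless : count special ≤ 2 * count childlessInHost
  special≤2*childless = begin
    count special                                              ≤⟨ count-∨ (λ v → (v == zero) ∨ childlessInHost v) branching ⟩
    count (λ v → (v == zero) ∨ childlessInHost v) + count branching
                                                               ≤⟨ +-monoˡ-≤ (count branching) (count-∨ (λ (v : V) → v == zero) childlessInHost) ⟩
    count (λ (v : V) → v == zero) + count childlessInHost + count branching
                                                               ≤⟨ +-monoˡ-≤ (count branching) (+-monoˡ-≤ (count childlessInHost) at-most-one-root) ⟩
    1 + count childlessInHost + count branching                ≡⟨ cong suc (+-comm (count childlessInHost) (count branching)) ⟩
    suc (count branching) + count childlessInHost             ≤⟨ +-monoˡ-≤ (count childlessInHost) branching<childless ⟩
    count childlessInHost + count childlessInHost             ≡⟨ cong (count childlessInHost +_) (sym (+-identityʳ _)) ⟩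
    2 * count childlessInHost                                  ∎
    where
    open ≤-Reasoning
    at-most-one-root : count (λ (v : V) → v == zero) ≤ 1
    at-most-one-root = count-unique≤1 (λ (v : V) → v == zero) (λ i j p q → trans (==⇒≡ p) (sym (==⇒≡ q)))

2*[2*k*4]≡16*k : ∀ k → 2 * (2 * k * 4) ≡ 16 * k
2*[2*k*4]≡16*k = solve-∀

one-differs : ∀ {m} {i j x : Fin m} → i ≢ j → i ≢ x ⊎ j ≢ x
one-differs {i = i} {j} {x} i≢j with i F.≟ x
... | yes refl = inj₂ (λ j≡i → i≢j (sym j≡i))
... | no i≢x = inj₁ i≢x

module SpecialGraph {n : ℕ} (Tr : TreeSpace n) {N : ℕ} (O : Fin N → Subset n)
                    (CO : ∀ i → Connected Tr (O i)) where

  open RootedTree Tr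
  open SpecialVertices Tr
  open Objects Tr O CO
  open EdgeGraph {N}

  meetsSpecial : Fin N → Bool
  meetsSpecial A = anyᵇ (λ v → O A v ∧ special v)

  avoidsSpecial⇒childless≤1 : ∀ A → meetsSpecial A ≡ false → count (childlessIn (O A)) ≤ 1
  avoidsSpecial⇒childless≤1 A avoids = count-unique≤1 (childlessIn (O A)) same
    where
    open Subtree (O A) (CO A) using (childless-antichain)
    same : ∀ a a′ → childlessIn (O A) a ≡ true → childlessIn (O A) a′ ≡ true → a ≡ a′
    same a a′ ca ca′ with a F.≟ a′
    ... | yes a≡a′ = a≡a′
    ... | no a≢a′ = ⊥-elim (bool-absurd (anyᵇ-intro (λ v → O A v ∧ special v) m (∧-intro om sm)) avoids)
      where
      oa = ∧-elimˡ {O A a} ca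
      oa′ = ∧-elimˡ {O A a′} ca′
      fork = fork-special a a′ (λ p → a≢a′ (childless-antichain a a′ ca ca′ p))
                               (λ p → a≢a′ (sym (childless-antichain a′ a ca′ ca p)))
      m = proj₁ fork
      ma = proj₁ (proj₂ fork)
      sm = proj₁ (proj₂ (proj₂ (proj₂ fork)))
      om : O A m ≡ true
      om = between-in A (anc-linear-≤ (top-anc A a oa) ma
                          (proj₂ (proj₂ (proj₂ (proj₂ fork))) (top A) (top-anc A a oa) (top-anc A a′ oa′))) ma oa

  properSpecialAncestor : V → V → Bool
  properSpecialAncestor s v = special v ∧ (ancᵇ v s ∧ not (v == s))

  specialAbove : V → V
  specialAbove s with argmax? (properSpecialAncestor s) toℕ
  ... | inj₁ r = Best.elem r
  ... | inj₂ _ = zero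

  specialAbove-spec : ∀ s → s ≢ zero → properSpecialAncestor s (specialAbove s) ≡ true ×
                      (∀ v → properSpecialAncestor s v ≡ true → toℕ v ≤ toℕ (specialAbove s))
  specialAbove-spec s s≢0 with argmax? (properSpecialAncestor s) toℕ
  ... | inj₁ (best a a∈ a-max) = a∈ , a-max
  ... | inj₂ none = ⊥-elim (bool-absurd (∧-intro root-special (∧-intro (ancᵇ-complete (root-anc s))
                                          (false⇒not-true (≢⇒==-false (λ e → s≢0 (sym e)))))) (none zero))

  fromAbove fromBelow : V → Fin N → Bool
  fromAbove s B = meetsSpecial B ∧ O B (specialAbove s)
  fromBelow s B = meetsSpecial B ∧ (not (O B (specialAbove s)) ∧ O B s)

  sharedPair aboveTwo belowTwo crossPair : V → List Edge
  sharedPair s = minTwo (λ B → meetsSpecial B ∧ O B s) toℕ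
  aboveTwo s = maxTwo (fromAbove s) (λ B → reach B s)
  belowTwo s = minTwo (fromBelow s) (λ B → toℕ (top B))
  crossPair s = mixedPair (fromAbove s) (λ B → reach B s) (fromBelow s) (λ B → toℕ (top B))

  edgesAt : V → List Edge
  edgesAt s = sharedPair s ++ aboveTwo s ++ belowTwo s ++ crossPair s

  edgesAt-length : ∀ s → length (edgesAt s) ≤ 4
  edgesAt-length s = ≤-trans (≤-reflexive (length-++ (sharedPair s)))
    (+-mono-≤ (bestTwo-length ≤-total ≤-trans ≤-refl _ _) (≤-trans (≤-reflexive (length-++ (aboveTwo s)))
    (+-mono-≤ (bestTwo-length ≥-total ≥-trans ≤-refl _ _) (≤-trans (≤-reflexive (length-++ (belowTwo s)))
    (+-mono-≤ (bestTwo-length ≤-total ≤-trans ≤-refl _ _) (mixedPair-length _ _ _ _))))))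

  graph : List Edge
  graph = concatMap edgesAt (enumerate special)

  graph-length : length graph ≤ count special * 4
  graph-length = ≤-trans (length-concatMap≤ edgesAt (enumerate special) 4 edgesAt-length)
                         (≤-reflexive (cong (_* 4) (length-enumerate special)))

  in-graph : ∀ s {u v} → special s ≡ true → hasEdge (edgesAt s) u v ≡ true → hasEdge graph u v ≡ true
  in-graph s {u} {v} sp e = hasEdge-concatMap⁺ edgesAt (enumerate special) s u v (∈ᵇ-enumerate⁺ special s sp) e

  sharedPair⊆ : ∀ s {u v} → special s ≡ true → hasEdge (sharedPair s) u v ≡ true → hasEdge graph u v ≡ true
  aboveTwo⊆ : ∀ s {u v} → special s ≡ true → hasEdge (aboveTwo s) u v ≡ true → hasEdge graph u v ≡ true
  belowTwo⊆ : ∀ s {u v} → special s ≡ true → hasEdge (belowTwo s) u v ≡ true → hasEdge graph u v ≡ true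
  crossPair⊆ : ∀ s {u v} → special s ≡ true → hasEdge (crossPair s) u v ≡ true → hasEdge graph u v ≡ true
  sharedPair⊆ s {u} {v} sp e = in-graph s sp (hasEdge-++⁺ˡ (sharedPair s) _ u v e)
  aboveTwo⊆ s {u} {v} sp e = in-graph s sp (hasEdge-++⁺ʳ (sharedPair s) _ u v (hasEdge-++⁺ˡ (aboveTwo s) _ u v e))
  belowTwo⊆ s {u} {v} sp e = in-graph s sp (hasEdge-++⁺ʳ (sharedPair s) _ u v (hasEdge-++⁺ʳ (aboveTwo s) _ u v
                                (hasEdge-++⁺ˡ (belowTwo s) (crossPair s) u v e)))
  crossPair⊆ s {u} {v} sp e = in-graph s sp (hasEdge-++⁺ʳ (sharedPair s) _ u v (hasEdge-++⁺ʳ (aboveTwo s) _ u v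
                                (hasEdge-++⁺ʳ (belowTwo s) (crossPair s) u v e)))

  SharedEdge : V → Set
  SharedEdge p = ∃ λ A → ∃ λ B → meetsSpecial A ≡ true × meetsSpecial B ≡ true ×
                 O A p ≡ true × O B p ≡ true × A ≢ B × hasEdge graph A B ≡ true

  SharedEdge-swap : ∀ {p} → SharedEdge p → SharedEdge p
  SharedEdge-swap (A , B , mA , mB , oA , oB , A≢B , e) =
    B , A , mB , mA , oB , oA , (λ q → A≢B (sym q)) , hasEdge-sym graph A B e

  first-special-below : ∀ p → ∃ λ s → special s ≡ true × Anc p s × (∀ v → special v ≡ true → Anc p v → toℕ s ≤ toℕ v)
  first-special-below p = s , ∧-elimˡ {special s} s∈ , ancᵇ-sound (∧-elimʳ {special s} s∈) ,
                          λ v sv pv → s-min v (∧-intro sv (ancᵇ-complete pv))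
    where
    open Best (argmin (λ v → special v ∧ ancᵇ p v) toℕ (leafBelow p)
                (∧-intro (childless-special _ (leafBelow-childless p)) (ancᵇ-complete (leafBelow-anc p))))
      renaming (elem to s; elem-∈ to s∈; elem-optimal to s-min)

  module Segment (p s : V) (s-special : special s ≡ true) (ps : Anc p s)
                 (s-first : ∀ v → special v ≡ true → Anc p v → toℕ s ≤ toℕ v) (s≢root : s ≢ zero) where

    a : V
    a = specialAbove s

    a∈ : properSpecialAncestor s a ≡ true
    a∈ = proj₁ (specialAbove-spec s s≢root)

    a-special : special a ≡ true
    a-special = ∧-elimˡ {special a} a∈

    as : Anc a s
    as = ancᵇ-sound (∧-elimˡ {ancᵇ a s} (∧-elimʳ {special a} a∈))

    a≢s : a ≢ s
    a≢s = ==-false⇒≢ (not-true⇒false (∧-elimʳ {ancᵇ a s} (∧-elimʳ {special a} a∈)))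

    a-max : ∀ v → special v ≡ true → Anc v s → v ≢ s → toℕ v ≤ toℕ a
    a-max v sv vs v≢s = proj₂ (specialAbove-spec s s≢root) v
                          (∧-intro sv (∧-intro (ancᵇ-complete vs) (false⇒not-true (≢⇒==-false v≢s))))

    ap : Anc a p
    ap with anc-linear as ps
    ... | inj₁ r = r
    ... | inj₂ pa = ⊥-elim (<-irrefl refl (<-≤-trans (anc-≢⇒< as a≢s) (s-first a a-special pa)))

    no-special-inside : ∀ {u v} → Anc a u → u ≢ a → Anc u v → Anc v s → v ≢ s → special v ≡ true → ⊥
    no-special-inside au u≢a uv vs v≢s sv =
      <-irrefl refl (<-≤-trans (anc-≢⇒< au (λ e → u≢a (sym e))) (≤-trans (anc⇒≤ uv) (a-max _ sv vs v≢s)))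

    special-descendant-below-s : ∀ {u x} → Anc a u → u ≢ a → Anc u s → Anc u x → special x ≡ true → Anc s x
    special-descendant-below-s {u} {x} au u≢a us ux sx with bool-cases (ancᵇ s x)
    ... | inj₁ s≼x = ancᵇ-sound s≼x
    ... | inj₂ s⋠x with bool-cases (ancᵇ x s)
    ...   | inj₁ x≼s = ⊥-elim (no-special-inside au u≢a ux (ancᵇ-sound x≼s) x≢s sx)
      where
      x≢s : x ≢ s
      x≢s e = bool-absurd (ancᵇ-complete (subst (Anc s) (sym e) anc-refl)) s⋠x
    ...   | inj₂ x⋠s = ⊥-elim (no-special-inside au u≢a um ms m≢s sm)
      where
      fork = fork-special s x (λ q → bool-absurd (ancᵇ-complete q) s⋠x) (λ q → bool-absurd (ancᵇ-complete q) x⋠s)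
      m = proj₁ fork
      ms = proj₁ (proj₂ fork)
      mx = proj₁ (proj₂ (proj₂ fork))
      sm = proj₁ (proj₂ (proj₂ (proj₂ fork)))
      um : Anc u m
      um = anc-linear-≤ us ms (proj₂ (proj₂ (proj₂ (proj₂ fork))) u us ux)
      m≢s : m ≢ s
      m≢s e = bool-absurd (ancᵇ-complete (subst (λ z → Anc z x) e mx)) s⋠x

    meets-endpoint : ∀ B → meetsSpecial B ≡ true → O B p ≡ true → O B a ≡ true ⊎ O B s ≡ true
    meets-endpoint B mB oB with anc-linear (top-anc B p oB) ap
    ... | inj₁ ta = inj₁ (between-in B ta ap oB)
    ... | inj₂ at with top B F.≟ a
    ...   | yes t≡a = inj₁ (subst (λ z → O B z ≡ true) t≡a (top-in B))
    ...   | no t≢a = inj₂ (between-in B ts (special-descendant-below-s at t≢a ts (top-anc B x ox) sx) ox)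
      where
      ts = anc-trans (top-anc B p oB) ps
      x-spec = anyᵇ-elim (λ v → O B v ∧ special v) mB
      x = proj₁ x-spec
      ox = ∧-elimˡ {O B x} (proj₂ x-spec)
      sx = ∧-elimʳ {O B x} (proj₂ x-spec)

    fromBelow-intro : ∀ B → meetsSpecial B ≡ true → O B p ≡ true → O B a ≡ false → fromBelow s B ≡ true
    fromBelow-intro B mB oB na with meets-endpoint B mB oB
    ... | inj₁ q = ⊥-elim (bool-absurd q na)
    ... | inj₂ q = ∧-intro mB (∧-intro (false⇒not-true na) q)

    fromAbove-covers : ∀ B → fromAbove s B ≡ true → toℕ p ≤ reach B s → O B p ≡ true
    fromAbove-covers B aB p≤reach = reach-covers B (∧-elimʳ {meetsSpecial B} aB) ap ps p≤reach

    fromBelow-covers : ∀ B → fromBelow s B ≡ true → toℕ (top B) ≤ toℕ p → O B p ≡ true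
    fromBelow-covers B bB top≤p = between-in B (anc-linear-≤ (top-anc B s os) ps top≤p) ps os
      where
      os = ∧-elimʳ {not (O B a)} (∧-elimʳ {meetsSpecial B} bB)

    both-above : ∀ i j → i ≢ j → fromAbove s i ≡ true → fromAbove s j ≡ true → O i p ≡ true → O j p ≡ true →
                 SharedEdge p
    both-above i j i≢j ai aj oi oj with bestTwo-spec ≥-total ≥-trans ≤-refl (fromAbove s) (λ B → reach B s) i j ai aj i≢j
    ... | (x , y , e , ax , ay , x≢y , x-max , y-max) =
      x , y , ∧-elimˡ {meetsSpecial x} ax , ∧-elimˡ {meetsSpecial y} ay ,
      fromAbove-covers x ax (≤-trans (reach-≥ i s p oi ps) (x-max i ai)) ,
      fromAbove-covers y ay y-deep , x≢y , aboveTwo⊆ s s-special e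
      where
      y-deep : toℕ p ≤ reach y s
      y-deep with one-differs {x = x} i≢j
      ... | inj₁ i≢x = ≤-trans (reach-≥ i s p oi ps) (y-max i ai i≢x)
      ... | inj₂ j≢x = ≤-trans (reach-≥ j s p oj ps) (y-max j aj j≢x)

    both-below : ∀ i j → i ≢ j → fromBelow s i ≡ true → fromBelow s j ≡ true → O i p ≡ true → O j p ≡ true →
                 SharedEdge p
    both-below i j i≢j bi bj oi oj with bestTwo-spec ≤-total ≤-trans ≤-refl (fromBelow s) (λ B → toℕ (top B)) i j bi bj i≢j
    ... | (x , y , e , bx , by , x≢y , x-min , y-min) =
      x , y , ∧-elimˡ {meetsSpecial x} bx , ∧-elimˡ {meetsSpecial y} by ,
      fromBelow-covers x bx (≤-trans (x-min i bi) (anc⇒≤ (top-anc i p oi))) ,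
      fromBelow-covers y by y-high , x≢y , belowTwo⊆ s s-special e
      where
      y-high : toℕ (top y) ≤ toℕ p
      y-high with one-differs {x = x} i≢j
      ... | inj₁ i≢x = ≤-trans (y-min i bi i≢x) (anc⇒≤ (top-anc i p oi))
      ... | inj₂ j≢x = ≤-trans (y-min j bj j≢x) (anc⇒≤ (top-anc j p oj))

    cross : ∀ i j → fromAbove s i ≡ true → fromBelow s j ≡ true → O i p ≡ true → O j p ≡ true → SharedEdge p
    cross i j ai bj oi oj
      with mixedPair-spec (fromAbove s) (λ B → reach B s) (fromBelow s) (λ B → toℕ (top B)) i j ai bj
    ... | (x , y , e , ax , by , x-max , y-min) =
      x , y , ∧-elimˡ {meetsSpecial x} ax , ∧-elimˡ {meetsSpecial y} by ,
      fromAbove-covers x ax (≤-trans (reach-≥ i s p oi ps) (x-max i ai)) ,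
      fromBelow-covers y by (≤-trans (y-min j bj) (anc⇒≤ (top-anc j p oj))) ,
      x≢y , crossPair⊆ s s-special e
      where
      x≢y : x ≢ y
      x≢y refl = bool-absurd (∧-elimʳ {meetsSpecial x} ax)
                             (not-true⇒false (∧-elimˡ {not (O x a)} (∧-elimʳ {meetsSpecial x} by)))

    segment-edge : ∀ i j → i ≢ j → meetsSpecial i ≡ true → meetsSpecial j ≡ true → O i p ≡ true → O j p ≡ true →
                   SharedEdge p
    segment-edge i j i≢j mi mj oi oj with bool-cases (O i a) | bool-cases (O j a)
    ... | inj₁ ia | inj₁ ja = both-above i j i≢j (∧-intro mi ia) (∧-intro mj ja) oi oj
    ... | inj₂ ia | inj₂ ja = both-below i j i≢j (fromBelow-intro i mi oi ia) (fromBelow-intro j mj oj ja) oi oj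
    ... | inj₁ ia | inj₂ ja = cross i j (∧-intro mi ia) (fromBelow-intro j mj oj ja) oi oj
    ... | inj₂ ia | inj₁ ja = SharedEdge-swap (cross j i (∧-intro mj ja) (fromBelow-intro i mi oi ia) oj oi)

  shared-edge : ∀ p i j → i ≢ j → meetsSpecial i ≡ true → meetsSpecial j ≡ true → O i p ≡ true → O j p ≡ true →
                SharedEdge p
  shared-edge p i j i≢j mi mj oi oj with bool-cases (special p)
  ... | inj₂ ns = let (s , s-special , ps , s-first) = first-special-below p in
                 Segment.segment-edge p s s-special ps s-first
                   (λ e → nonspecial≢root p ns (anc-of-root (subst (Anc p) e ps))) i j i≢j mi mj oi oj
  ... | inj₁ sp with bestTwo-spec ≤-total ≤-trans ≤-refl (λ B → meetsSpecial B ∧ O B p) toℕ i j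
                                  (∧-intro mi oi) (∧-intro mj oj) i≢j
  ...   | (x , y , e , px , py , x≢y , _ , _) =
          x , y , ∧-elimˡ {meetsSpecial x} px , ∧-elimˡ {meetsSpecial y} py ,
          ∧-elimʳ {meetsSpecial x} px , ∧-elimʳ {meetsSpecial y} py , x≢y , sharedPair⊆ p sp e

  module Colouring (k δ : ℕ) (hk : hostLeaves Tr ≤ k) (hδ : 16 * k < suc δ * suc (suc δ)) where

    graph-size : 2 * length graph ≤ 16 * k
    graph-size = ≤-trans (*-monoʳ-≤ 2 (≤-trans graph-length (*-monoˡ-≤ 4 special≤2k))) (≤-reflexive (2*[2*k*4]≡16*k k))
      where
      special≤2k : count special ≤ 2 * k
      special≤2k = ≤-trans special≤2*childless (*-monoʳ-≤ 2 (≤-trans childlessInHost≤hostLeaves hk))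

    -- A subgraph of minimum degree above δ has more than δ + 1 vertices, hence more than 8k edges.
    degenerate : ∀ (H : Fin N → Bool) h → H h ≡ true →
                 ∃ λ A → H A ≡ true × count (λ B → H B ∧ adjacent graph A B) ≤ δ
    degenerate H h hh with low-degree graph H h hh
    ... | A , hA , sparse with degreeIn graph H A ≤? δ
    ...   | yes small = A , hA , small
    ...   | no big = ⊥-elim (<-irrefl refl (<-≤-trans hδ (begin
            suc δ * suc (suc δ)            ≤⟨ *-mono-≤ deg> (≤-trans (s≤s deg>) (degreeIn<size graph H A hA)) ⟩
            degreeIn graph H A * count H   ≡⟨ *-comm (degreeIn graph H A) (count H) ⟩
            count H * degreeIn graph H A   ≤⟨ sparse ⟩
            2 * edgesWithin H graph        ≤⟨ *-monoʳ-≤ 2 (edgesWithin≤length H graph) ⟩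
            2 * length graph               ≤⟨ graph-size ⟩
            16 * k                         ∎)))
      where
      open ≤-Reasoning
      deg> : suc δ ≤ degreeIn graph H A
      deg> = ≰⇒> big

    open LeafPointers.Degenerate Tr O CO (λ A → not (meetsSpecial A)) 1
           (λ A φ → avoidsSpecial⇒childless≤1 A (not-true⇒false φ))
      using () renaming (nm-colouring to avoiding-colouring)
    open GreedyColouring δ (adjacent graph) (adjacent-sym graph) (adjacent-irrefl graph) degenerate
      using () renaming (colouring to meeting-colouring)
    open TwoPalettes meetsSpecial (proj₁ avoiding-colouring) (proj₁ meeting-colouring)

    nm-colouring : ∃ λ (c : Fin N → Fin (2 + suc δ)) → NM O c
    nm-colouring = joint , λ p (i , j , i≢j , oi , oj) →
                             by-kind p i j i≢j oi oj (bool-cases (meetsSpecial i)) (bool-cases (meetsSpecial j))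
      where
      by-kind : ∀ p i j → i ≢ j → O i p ≡ true → O j p ≡ true →
                meetsSpecial i ≡ true ⊎ meetsSpecial i ≡ false → meetsSpecial j ≡ true ⊎ meetsSpecial j ≡ false →
                ∃[ A ] ∃[ B ] (O A p ≡ true × O B p ≡ true × joint A ≢ joint B)
      by-kind p i j i≢j oi oj (inj₁ mi) (inj₁ mj) =
        let (A , B , mA , mB , oA , oB , A≢B , e) = shared-edge p i j i≢j mi mj oi oj in
        A , B , oA , oB , joint-≢₁ A B mA mB (proj₂ meeting-colouring A B (adjacent-intro graph A≢B e))
      by-kind p i j i≢j oi oj (inj₂ mi) (inj₂ mj) =
        let (A , B , φA , φB , oA , oB , ne) =
              proj₂ avoiding-colouring p i j i≢j (false⇒not-true mi) (false⇒not-true mj) oi oj in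
        A , B , oA , oB , joint-≢₀ A B (not-true⇒false φA) (not-true⇒false φB) ne
      by-kind p i j i≢j oi oj (inj₁ mi) (inj₂ mj) = i , j , oi , oj , joint-≢₁₀ i j mi mj
      by-kind p i j i≢j oi oj (inj₂ mi) (inj₁ mj) = i , j , oi , oj , λ q → joint-≢₁₀ j i mj mi (sym q)

module HeavyPaths {n : ℕ} (Tr : TreeSpace n) where

  open RootedTree Tr

  leavesBelow : V → ℕ
  leavesBelow v = count (λ u → childlessInHost u ∧ ancᵇ v u)

  leavesBelow-anti : ∀ {v w} → Anc v w → leavesBelow w ≤ leavesBelow v
  leavesBelow-anti {v} {w} vw = count-mono _ _ (λ u p →
    ∧-intro (∧-elimˡ {childlessInHost u} p)
            (ancᵇ-complete {v} {u} (anc-trans vw (ancᵇ-sound {w} {u} (∧-elimʳ {childlessInHost u} p)))))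

  leavesBelow-pos : ∀ v → 1 ≤ leavesBelow v
  leavesBelow-pos v = count-pos (λ u → childlessInHost u ∧ ancᵇ v u) (leafBelow v)
                                (∧-intro (leafBelow-childless v) (ancᵇ-complete {v} (leafBelow-anc v)))

  leavesBelow≤total : ∀ v → leavesBelow v ≤ count childlessInHost
  leavesBelow≤total v = count-mono _ _ (λ u p → ∧-elimˡ {childlessInHost u} {ancᵇ v u} p)

  heavy : V → Bool
  heavy zero = false
  heavy (suc i) = leavesBelow (parent Tr i) <ᵇ 2 * leavesBelow (suc i)

  light-halves : ∀ i → heavy (suc i) ≡ false → 2 * leavesBelow (suc i) ≤ leavesBelow (parent Tr i)
  light-halves i e with leavesBelow (parent Tr i) <? 2 * leavesBelow (suc i)
  ... | yes lt = ⊥-elim (bool-absurd (<⇒<ᵇ′ lt) e)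
  ... | no nlt = ≮⇒≥ nlt

  heavy⇒more-than-half : ∀ i → heavy (suc i) ≡ true → leavesBelow (parent Tr i) < 2 * leavesBelow (suc i)
  heavy⇒more-than-half i e = <ᵇ⇒<′ {leavesBelow (parent Tr i)} {2 * leavesBelow (suc i)} e

  heavy-unique : ∀ i j → heavy (suc i) ≡ true → heavy (suc j) ≡ true → parent Tr i ≡ parent Tr j → i ≡ j
  heavy-unique i j hi hj e with i F.≟ j
  ... | yes i≡j = i≡j
  ... | no i≢j = ⊥-elim (<-irrefl refl (begin-strict
      leavesBelow P + leavesBelow P
        <⟨ +-mono-< (heavy⇒more-than-half i hi)
                    (subst (λ z → leavesBelow z < 2 * leavesBelow (suc j)) (sym e) (heavy⇒more-than-half j hj)) ⟩
      2 * leavesBelow (suc i) + 2 * leavesBelow (suc j)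
        ≡⟨ sym (*-distribˡ-+ 2 (leavesBelow (suc i)) (leavesBelow (suc j))) ⟩
      2 * (leavesBelow (suc i) + leavesBelow (suc j))
        ≤⟨ *-monoʳ-≤ 2 children≤parent ⟩
      2 * leavesBelow P
        ≡⟨ cong (leavesBelow P +_) (+-identityʳ (leavesBelow P)) ⟩
      leavesBelow P + leavesBelow P ∎))
    where
    open ≤-Reasoning
    P = parent Tr i
    below : V → V → Bool
    below v u = childlessInHost u ∧ ancᵇ v u
    disjoint : ∀ u → below (suc i) u ≡ true → below (suc j) u ≡ true → ⊥
    disjoint u p q = i≢j (siblings-disjoint e (ancᵇ-sound {suc i} {u} (∧-elimʳ {childlessInHost u} p))
                                              (ancᵇ-sound {suc j} {u} (∧-elimʳ {childlessInHost u} q)))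
    lift : ∀ {c} → Anc P c → ∀ u → below c u ≡ true → below P u ≡ true
    lift {c} Pc u p = ∧-intro (∧-elimˡ {childlessInHost u} p)
                          (ancᵇ-complete {P} {u} (anc-trans Pc (ancᵇ-sound {c} {u} (∧-elimʳ {childlessInHost u} p))))
    children≤parent : leavesBelow (suc i) + leavesBelow (suc j) ≤ leavesBelow P
    children≤parent = ≤-trans (count-∨-disjoint (below (suc i)) (below (suc j)) disjoint)
      (count-mono (λ u → below (suc i) u ∨ below (suc j) u) (below P)
        (λ u p → [ lift (anc-step i anc-refl) u , lift (subst (λ z → Anc z (suc j)) (sym e) (anc-step j anc-refl)) u ]′
                   (∨-elim {below (suc i) u} p)))

  headFuel : ℕ → V → V
  headFuel zero v = v
  headFuel (suc f) zero = zero
  headFuel (suc f) (suc i) = if heavy (suc i) then headFuel f (parent Tr i) else suc i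

  head : V → V
  head v = headFuel (toℕ v) v

  headFuel-enough : ∀ f v → toℕ v ≤ f → headFuel f v ≡ head v
  headFuel-enough f v le = go f (toℕ v) v le ≤-refl
    where
    go : ∀ f g v → toℕ v ≤ f → toℕ v ≤ g → headFuel f v ≡ headFuel g v
    go zero zero v _ _ = refl
    go zero (suc g) zero _ _ = refl
    go (suc f) zero zero _ _ = refl
    go (suc f) (suc g) zero _ _ = refl
    go (suc f) (suc g) (suc i) lf lg with heavy (suc i)
    ... | false = refl
    ... | true = go f g (parent Tr i) (≤-trans (parent< Tr i) (≤-pred lf)) (≤-trans (parent< Tr i) (≤-pred lg))

  head-heavy : ∀ i → heavy (suc i) ≡ true → head (suc i) ≡ head (parent Tr i)
  head-heavy i e rewrite e = headFuel-enough (toℕ i) (parent Tr i) (parent< Tr i)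

  head-light : ∀ v → heavy v ≡ false → head v ≡ v
  head-light zero e = refl
  head-light (suc i) e rewrite e = refl

  head-anc : ∀ v → Anc (head v) v
  head-anc = index-induction (λ v → Anc (head v) v) from-smaller
    where
    from-smaller : ∀ v → (∀ w → toℕ w < toℕ v → Anc (head w) w) → Anc (head v) v
    from-smaller zero ih = anc-refl
    from-smaller (suc i) ih with bool-cases (heavy (suc i))
    ... | inj₂ e = subst (λ z → Anc z (suc i)) (sym (head-light (suc i) e)) anc-refl
    ... | inj₁ e = subst (λ z → Anc z (suc i)) (sym (head-heavy i e)) (anc-step i (ih (parent Tr i) (parent<child i)))

  below-head-heavy : ∀ y → y ≢ head y → ∃ λ i → y ≡ suc i × heavy (suc i) ≡ true × head (parent Tr i) ≡ head y
  below-head-heavy zero y≢h = ⊥-elim (y≢h refl)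
  below-head-heavy (suc i) y≢h with bool-cases (heavy (suc i))
  ... | inj₂ e = ⊥-elim (y≢h (sym (head-light (suc i) e)))
  ... | inj₁ e = i , refl , e , sym (head-heavy i e)

  head-between : ∀ {h y x} → head x ≡ h → Anc h y → Anc y x → head y ≡ h
  head-between e hy anc-refl = e
  head-between {h} {y} {suc i} e hy (anc-step .i q) with suc i F.≟ h
  ... | yes refl = trans (cong head (anc-antisym (anc-step i q) hy)) e
  ... | no i≢h with below-head-heavy (suc i) (λ z → i≢h (trans z e))
  ...   | (.i , refl , _ , eq) = head-between (trans eq e) hy q

  same-head⇒anc : ∀ y x → head x ≡ head y → toℕ x ≤ toℕ y → Anc x y
  same-head⇒anc = index-induction (λ y → ∀ x → head x ≡ head y → toℕ x ≤ toℕ y → Anc x y) from-smaller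
    where
    from-smaller : ∀ y → (∀ w → toℕ w < toℕ y → ∀ x → head x ≡ head w → toℕ x ≤ toℕ w → Anc x w) →
                   ∀ x → head x ≡ head y → toℕ x ≤ toℕ y → Anc x y
    from-smaller y ih x e x≤y with x F.≟ y
    ... | yes refl = anc-refl
    ... | no x≢y with y F.≟ head y
    ...   | yes y≡h = ⊥-elim (<-irrefl refl (<-≤-trans (≤∧≢⇒< x≤y (λ q → x≢y (toℕ-injective q)))
                        (≤-trans (≤-reflexive (cong toℕ (trans y≡h (sym e)))) (anc⇒≤ (head-anc x)))))
    ...   | no y≢h with below-head-heavy y y≢h
    ...     | (i , refl , hv , eq) with toℕ x ≤? toℕ (parent Tr i)
    ...       | yes x≤pi = anc-step i (ih (parent Tr i) (parent<child i) x (trans e (sym eq)) x≤pi)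
    ...       | no x≰pi = ⊥-elim (<-irrefl refl (<-≤-trans x<y (anc⇒≤ y≼x)))
      where
      x<y : toℕ x < suc (toℕ i)
      x<y = ≤∧≢⇒< x≤y (λ q → x≢y (toℕ-injective q))
      pi≼x : Anc (parent Tr i) x
      pi≼x = ih x x<y (parent Tr i) (trans eq (sym e)) (<⇒≤ (≰⇒> x≰pi))
      toward = child-toward pi≼x (λ q → x≰pi (≤-reflexive (cong toℕ (sym q))))
      j = proj₁ toward
      j-head : head (suc j) ≡ head x
      j-head = head-between refl (anc-trans (subst (λ z → Anc z (parent Tr i)) (trans eq (sym e)) (head-anc (parent Tr i)))
                                            (subst (λ z → Anc z (suc j)) (proj₁ (proj₂ toward)) (anc-step j anc-refl)))
                                 (proj₂ (proj₂ toward))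
      j≢head : suc j ≢ head (suc j)
      j≢head q = <-irrefl refl (<-≤-trans (subst (λ z → toℕ z < suc (toℕ j)) (proj₁ (proj₂ toward)) (parent<child j))
                   (≤-trans (≤-reflexive (cong toℕ (trans q (trans j-head (trans e (sym eq))))))
                            (anc⇒≤ (head-anc (parent Tr i)))))
      j-heavy : heavy (suc j) ≡ true
      j-heavy with below-head-heavy (suc j) j≢head
      ... | (.j , refl , h , _) = h
      y≼x : Anc (suc i) x
      y≼x = subst (λ z → Anc (suc z) x) (heavy-unique j i j-heavy hv (proj₁ (proj₂ toward))) (proj₂ (proj₂ toward))

  headsFuel : ℕ → V → V → List V
  headsFuel zero t a = head t ∷ []
  headsFuel (suc f) t zero = head t ∷ []
  headsFuel (suc f) t (suc i) =
    if suc i == t then head t ∷ []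
    else (if heavy (suc i) then headsFuel f t (parent Tr i) else suc i ∷ headsFuel f t (parent Tr i))

  headsOnPath : V → V → List V
  headsOnPath t a = headsFuel (toℕ a) t a

  head-∈-headsFuel : ∀ f t a p → toℕ a ≤ f → Anc t p → Anc p a → (head p ∈ᵇ headsFuel f t a) ≡ true
  head-∈-headsFuel zero t zero p le tp pa rewrite anc-of-root pa | anc-of-root tp = ∈ᵇ-head (head zero) []
  head-∈-headsFuel (suc f) t zero p le tp pa rewrite anc-of-root pa | anc-of-root tp = ∈ᵇ-head (head zero) []
  head-∈-headsFuel (suc f) t (suc i) p le tp pa with bool-cases (suc i == t)
  ... | inj₁ e rewrite e | sym (==⇒≡ e) | anc-antisym pa tp = ∈ᵇ-head (head (suc i)) []
  ... | inj₂ e rewrite e with p F.≟ suc i | bool-cases (heavy (suc i))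
  ...   | yes refl | inj₁ h rewrite h | headFuel-enough (toℕ i) (parent Tr i) (parent< Tr i) =
          head-∈-headsFuel f t (parent Tr i) (parent Tr i) le′ (anc-parentOf tp (λ q → ==-false⇒≢ e (sym q))) anc-refl
    where le′ = ≤-trans (parent< Tr i) (≤-pred le)
  ...   | yes refl | inj₂ h rewrite h = ∈ᵇ-head (suc i) (headsFuel f t (parent Tr i))
  ...   | no p≢i | inj₁ h rewrite h =
          head-∈-headsFuel f t (parent Tr i) p (≤-trans (parent< Tr i) (≤-pred le)) tp (anc-parentOf pa p≢i)
  ...   | no p≢i | inj₂ h rewrite h =
          ∨-introʳ {suc i == head p}
                   (head-∈-headsFuel f t (parent Tr i) p (≤-trans (parent< Tr i) (≤-pred le)) tp (anc-parentOf pa p≢i))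

  -- Every light vertex on the path at least halves the number of leaves below.
  headsFuel-length : ∀ f t a → toℕ a ≤ f → Anc t a → 2 ^ length (headsFuel f t a) * leavesBelow a ≤ 2 * leavesBelow t
  headsFuel-length zero t zero le ta rewrite anc-of-root ta = ≤-refl
  headsFuel-length (suc f) t zero le ta rewrite anc-of-root ta = ≤-refl
  headsFuel-length (suc f) t (suc i) le ta with bool-cases (suc i == t)
  ... | inj₁ e rewrite e | sym (==⇒≡ e) = ≤-refl
  ... | inj₂ e rewrite e with bool-cases (heavy (suc i))
  ...   | inj₁ h rewrite h =
          ≤-trans (*-monoʳ-≤ (2 ^ length rest) (leavesBelow-anti (anc-step i anc-refl))) (headsFuel-length f t (parent Tr i) le′ t≼pi)
    where
    rest = headsFuel f t (parent Tr i)
    le′ = ≤-trans (parent< Tr i) (≤-pred le)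
    t≼pi = anc-parentOf ta (λ q → ==-false⇒≢ e (sym q))
  ...   | inj₂ h rewrite h = begin
          2 * 2 ^ length rest * leavesBelow (suc i)   ≡⟨ cong (_* leavesBelow (suc i)) (*-comm 2 (2 ^ length rest)) ⟩
          2 ^ length rest * 2 * leavesBelow (suc i)   ≡⟨ *-assoc (2 ^ length rest) 2 (leavesBelow (suc i)) ⟩
          2 ^ length rest * (2 * leavesBelow (suc i)) ≤⟨ *-monoʳ-≤ (2 ^ length rest) (light-halves i h) ⟩
          2 ^ length rest * leavesBelow (parent Tr i) ≤⟨ headsFuel-length f t (parent Tr i) le′ t≼pi ⟩
          2 * leavesBelow t                           ∎
    where
    open ≤-Reasoning
    rest = headsFuel f t (parent Tr i)
    le′ = ≤-trans (parent< Tr i) (≤-pred le)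
    t≼pi = anc-parentOf ta (λ q → ==-false⇒≢ e (sym q))

module CFColouring {n : ℕ} (Tr : TreeSpace n) {N : ℕ} (O : Fin N → Subset n)
                   (CO : ∀ i → Connected Tr (O i)) where

  open RootedTree Tr
  open HeavyPaths Tr
  open Objects Tr O CO
  open EdgeGraph {N}

  covered : V → Bool
  covered p = anyᵇ (λ B → O B p)

  bottomOn : Fin N → V → ℕ
  bottomOn B h with argmax? (λ v → O B v ∧ (head v == h)) toℕ
  ... | inj₁ r = toℕ (Best.elem r)
  ... | inj₂ _ = 0

  bottomOnL : Fin N → V → List V
  bottomOnL B h with argmax? (λ v → O B v ∧ (head v == h)) toℕ
  ... | inj₁ r = Best.elem r ∷ []
  ... | inj₂ _ = []

  bottomOnL-length : ∀ B h → length (bottomOnL B h) ≤ 1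
  bottomOnL-length B h with argmax? (λ v → O B v ∧ (head v == h)) toℕ
  ... | inj₁ r = ≤-refl
  ... | inj₂ _ = z≤n

  bottomOn-spec : ∀ B h v → O B v ≡ true → head v ≡ h →
    ∃ λ b → O B b ≡ true × head b ≡ h × toℕ v ≤ toℕ b × bottomOn B h ≡ toℕ b × bottomOnL B h ≡ b ∷ []
  bottomOn-spec B h v ov hv with argmax? (λ v → O B v ∧ (head v == h)) toℕ
  ... | inj₁ (best b b∈ b-max) = b , ∧-elimˡ {O B b} b∈ , ==⇒≡ (∧-elimʳ {O B b} b∈) ,
                                 b-max v (∧-intro ov (subst (λ z → (head v == z) ≡ true) hv (==-refl (head v)))) , refl , refl
  ... | inj₂ none = ⊥-elim (bool-absurd (∧-intro ov (subst (λ z → (head v == z) ≡ true) hv (==-refl (head v)))) (none v))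

  -- The witness chosen at the start of a segment is the uniquely coloured object on the whole segment.
  witnessL : V → List (Fin N)
  witnessL x with argmax? (λ B → O B x) (λ B → bottomOn B (head x))
  ... | inj₁ r = Best.elem r ∷ []
  ... | inj₂ _ = []

  witnessL-length : ∀ x → length (witnessL x) ≤ 1
  witnessL-length x with argmax? (λ B → O B x) (λ B → bottomOn B (head x))
  ... | inj₁ r = ≤-refl
  ... | inj₂ _ = z≤n

  witness-spec : ∀ x B₀ → O B₀ x ≡ true → ∃ λ B → witnessL x ≡ B ∷ [] × O B x ≡ true ×
                 (∀ B′ → O B′ x ≡ true → bottomOn B′ (head x) ≤ bottomOn B (head x))
  witness-spec x B₀ o with argmax? (λ B → O B x) (λ B → bottomOn B (head x))
  ... | inj₁ (best B B∈ B-max) = B , refl , B∈ , B-max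
  ... | inj₂ none = ⊥-elim (bool-absurd o (none B₀))

  witness-in : ∀ x B → witnessL x ≡ B ∷ [] → O B x ≡ true
  witness-in x B e with argmax? (λ B → O B x) (λ B → bottomOn B (head x))
  witness-in x B refl | inj₁ (best .B B∈ _) = B∈

  bottomOfFirst : List (Fin N) → V → ℕ
  bottomOfFirst [] h = 0
  bottomOfFirst (B ∷ _) h = bottomOn B h

  witnessReach : V → ℕ
  witnessReach x = bottomOfFirst (witnessL x) (head x)

  -- Heavy paths are cut greedily into segments: a vertex stays in the segment of its parent
  -- as long as the witness chosen at the segment's start still reaches it.
  extends : ℕ → Fin n → Bool
  startFuel : ℕ → V → V
  extends f i = heavy (suc i) ∧ (covered (parent Tr i) ∧ (suc (toℕ i) ≤ᵇ witnessReach (startFuel f (parent Tr i))))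
  startFuel zero v = v
  startFuel (suc f) zero = zero
  startFuel (suc f) (suc i) = if extends f i then startFuel f (parent Tr i) else suc i

  start : V → V
  start v = startFuel (toℕ v) v

  startFuel-enough : ∀ f g v → toℕ v ≤ f → toℕ v ≤ g → startFuel f v ≡ startFuel g v
  startFuel-enough zero zero v _ _ = refl
  startFuel-enough zero (suc g) zero _ _ = refl
  startFuel-enough (suc f) zero zero _ _ = refl
  startFuel-enough (suc f) (suc g) zero _ _ = refl
  startFuel-enough (suc f) (suc g) (suc i) lf lg
    rewrite startFuel-enough f g (parent Tr i) (≤-trans (parent< Tr i) (≤-pred lf)) (≤-trans (parent< Tr i) (≤-pred lg)) = refl

  start-parent : ∀ i → startFuel (toℕ i) (parent Tr i) ≡ start (parent Tr i)
  start-parent i = startFuel-enough (toℕ i) (toℕ (parent Tr i)) (parent Tr i) (parent< Tr i) ≤-refl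

  start-extends : ∀ i → heavy (suc i) ≡ true → covered (parent Tr i) ≡ true →
                  suc (toℕ i) ≤ witnessReach (start (parent Tr i)) → start (suc i) ≡ start (parent Tr i)
  start-extends i h c le = trans (cong (λ b → if b then startFuel (toℕ i) (parent Tr i) else suc i) ext) (start-parent i)
    where
    ext : extends (toℕ i) i ≡ true
    ext = ∧-intro h (∧-intro c (≤⇒≤ᵇ′ (subst (λ z → suc (toℕ i) ≤ witnessReach z) (sym (start-parent i)) le)))

  start-cases : ∀ i → start (suc i) ≡ suc i ⊎
                (heavy (suc i) ≡ true × covered (parent Tr i) ≡ true ×
                 suc (toℕ i) ≤ witnessReach (start (parent Tr i)) × start (suc i) ≡ start (parent Tr i))
  start-cases i with bool-cases (extends (toℕ i) i)
  ... | inj₂ e rewrite e = inj₁ refl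
  ... | inj₁ e = inj₂ (h , c , le , start-extends i h c le)
    where
    h = ∧-elimˡ {heavy (suc i)} e
    c = ∧-elimˡ {covered (parent Tr i)} (∧-elimʳ {heavy (suc i)} e)
    le = subst (λ z → suc (toℕ i) ≤ witnessReach z) (start-parent i)
               (≤ᵇ⇒≤′ (∧-elimʳ {covered (parent Tr i)} (∧-elimʳ {heavy (suc i)} e)))

  start-on-path : ∀ v → head (start v) ≡ head v × Anc (start v) v
  start-on-path = index-induction _ from-smaller
    where
    from-smaller : ∀ v → (∀ w → toℕ w < toℕ v → head (start w) ≡ head w × Anc (start w) w) →
                   head (start v) ≡ head v × Anc (start v) v
    from-smaller zero ih = refl , anc-refl
    from-smaller (suc i) ih with start-cases i
    ... | inj₁ e rewrite e = refl , anc-refl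
    ... | inj₂ (h , _ , _ , e) rewrite e =
          trans (proj₁ (ih (parent Tr i) (parent<child i))) (sym (head-heavy i h)) ,
          anc-step i (proj₂ (ih (parent Tr i) (parent<child i)))

  witness-covers : ∀ p B₀ → O B₀ p ≡ true → ∃ λ B → witnessL (start p) ≡ B ∷ [] × O B p ≡ true
  witness-covers = index-induction _ from-smaller
    where
    Goal : V → Set
    Goal p = ∃ λ B → witnessL (start p) ≡ B ∷ [] × O B p ≡ true
    at-start : ∀ p B₀ → O B₀ p ≡ true → start p ≡ p → Goal p
    at-start p B₀ o e rewrite e = let (B , eq , oB , _) = witness-spec p B₀ o in B , eq , oB
    from-smaller : ∀ p → (∀ w → toℕ w < toℕ p → ∀ B₀ → O B₀ w ≡ true → Goal w) → ∀ B₀ → O B₀ p ≡ true → Goal p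
    from-smaller zero ih B₀ o = at-start zero B₀ o refl
    from-smaller (suc i) ih B₀ o with start-cases i
    ... | inj₁ e = at-start (suc i) B₀ o e
    ... | inj₂ (h , c , le , e) = B , subst (λ z → witnessL z ≡ B ∷ []) (sym e) eqB , oB
      where
      x = start (parent Tr i)
      IH = let (B₁ , oB₁) = anyᵇ-elim (λ B → O B (parent Tr i)) c in ih (parent Tr i) (parent<child i) B₁ oB₁
      B = proj₁ IH
      eqB = proj₁ (proj₂ IH)
      oBx = witness-in x B eqB
      b-spec = bottomOn-spec B (head x) x oBx refl
      b = proj₁ b-spec
      same-path : head b ≡ head (suc i)
      same-path = trans (proj₁ (proj₂ (proj₂ b-spec))) (trans (proj₁ (start-on-path (parent Tr i))) (sym (head-heavy i h)))
      deep-enough : toℕ (suc i) ≤ toℕ b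
      deep-enough = ≤-trans le (≤-reflexive (trans (cong (λ L → bottomOfFirst L (head x)) eqB)
                                                    (proj₁ (proj₂ (proj₂ (proj₂ (proj₂ b-spec)))))))
      oB : O B (suc i) ≡ true
      oB = between-in′ B oBx (anc-trans (proj₂ (start-on-path (parent Tr i))) (anc-step i anc-refl))
                       (same-head⇒anc b (suc i) (sym same-path) deep-enough) (proj₁ (proj₂ b-spec))

  heavyChildL : V → List V
  heavyChildL b = enumerate (λ c → heavy c ∧ childOf Tr c b)

  heavyChildL-length : ∀ b → length (heavyChildL b) ≤ 1
  heavyChildL-length b = ≤-trans (≤-reflexive (length-enumerate (λ c → heavy c ∧ childOf Tr c b))) (count-unique≤1 _ unique)
    where
    unique : ∀ c c′ → (heavy c ∧ childOf Tr c b) ≡ true → (heavy c′ ∧ childOf Tr c′ b) ≡ true → c ≡ c′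
    unique c c′ p q with childOf⇒parent {c} {b} (∧-elimʳ {heavy c} p) | childOf⇒parent {c′} {b} (∧-elimʳ {heavy c′} q)
    ... | (i , refl , pi) | (j , refl , pj) =
      cong suc (heavy-unique i j (∧-elimˡ {heavy (suc i)} p) (∧-elimˡ {heavy (suc j)} q) (trans pi (sym pj)))

  topOnPathL : Fin N → V → List V
  topOnPathL I h with argmin? (λ v → O I v ∧ (head v == h)) toℕ
  ... | inj₁ r = Best.elem r ∷ []
  ... | inj₂ _ = []

  topOnPathL-length : ∀ I h → length (topOnPathL I h) ≤ 1
  topOnPathL-length I h with argmin? (λ v → O I v ∧ (head v == h)) toℕ
  ... | inj₁ r = ≤-refl
  ... | inj₂ _ = z≤n

  topOnPathL-spec : ∀ I p → O I p ≡ true →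
    ∃ λ s → topOnPathL I (head p) ≡ s ∷ [] × O I s ≡ true × head s ≡ head p × toℕ s ≤ toℕ p
  topOnPathL-spec I p o with argmin? (λ v → O I v ∧ (head v == head p)) toℕ
  ... | inj₁ (best s s∈ s-min) = s , refl , ∧-elimˡ {O I s} s∈ , ==⇒≡ (∧-elimʳ {O I s} s∈) ,
                                 s-min p (∧-intro o (==-refl (head p)))
  ... | inj₂ none = ⊥-elim (bool-absurd (∧-intro o (==-refl (head p))) (none p))

  nextStartL : V → V → List V
  nextStartL h s = concatMap heavyChildL (concatMap (λ B → bottomOnL B h) (witnessL (start s)))

  witnessesFrom : V → V → List (Fin N)
  witnessesFrom h s = witnessL (start s) ++ concatMap witnessL (nextStartL h s)

  -- An object meets at most two segments of each heavy path.
  outOnPath : Fin N → V → List (Fin N)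
  outOnPath I h = concatMap (witnessesFrom h) (topOnPathL I h)

  outOnPath-length : ∀ I h → length (outOnPath I h) ≤ 2
  outOnPath-length I h = ≤-trans (length-concatMap≤ (witnessesFrom h) (topOnPathL I h) 2 two)
                                 (*-monoˡ-≤ 2 (topOnPathL-length I h))
    where
    length≤1 : ∀ {A : Set} {B : Set} (f : A → List B) xs → (∀ x → length (f x) ≤ 1) → length xs ≤ 1 → length (concatMap f xs) ≤ 1
    length≤1 f xs bound len = ≤-trans (length-concatMap≤ f xs 1 bound) (≤-trans (*-monoˡ-≤ 1 len) ≤-refl)
    two : ∀ s → length (witnessesFrom h s) ≤ 2
    two s = ≤-trans (≤-reflexive (length-++ (witnessL (start s))))
      (+-mono-≤ (witnessL-length (start s))
        (length≤1 witnessL (nextStartL h s) witnessL-length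
          (length≤1 heavyChildL (concatMap (λ B → bottomOnL B h) (witnessL (start s))) heavyChildL-length
            (length≤1 (λ B → bottomOnL B h) (witnessL (start s)) (λ B → bottomOnL-length B h) (witnessL-length (start s))))))

  witnessReach-≥ : ∀ I x v → O I x ≡ true → O I v ≡ true → head v ≡ head x → toℕ v ≤ witnessReach x
  witnessReach-≥ I x v ox ov hv with witness-spec x I ox | bottomOn-spec I (head x) v ov hv
  ... | (B′ , eB′ , _ , B′-max) | (_ , _ , _ , v≤b , eqI , _) =
    ≤-trans v≤b (≤-trans (≤-reflexive (sym eqI))
                (≤-trans (B′-max I ox) (≤-reflexive (sym (cong (λ L → bottomOfFirst L (head x)) eB′)))))

  module SegmentsMet (I : Fin N) (h s b : V) (os : O I s ≡ true) (hs : head s ≡ h) (hb : head b ≡ h)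
                     (s≤b : toℕ s ≤ toℕ b) (reach-s : witnessReach (start s) ≡ toℕ b) where

    Claim : V → Set
    Claim y = O I y ≡ true → head y ≡ h → Anc s y →
              (toℕ y ≤ toℕ b → start y ≡ start s) × (toℕ b < toℕ y → (start y ∈ᵇ heavyChildL b) ≡ true)

    module Step (i : Fin n) (ih : Claim (parent Tr i)) (oy : O I (suc i) ≡ true) (hy : head (suc i) ≡ h)
                (sy : Anc s (suc i)) (y≢s : suc i ≢ s) (hv : heavy (suc i) ≡ true)
                (same-head : head (parent Tr i) ≡ head (suc i)) where

      s≼pi : Anc s (parent Tr i)
      s≼pi = anc-parentOf sy (λ e → y≢s (sym e))

      opi : O I (parent Tr i) ≡ true
      opi = between-in′ I os s≼pi (anc-step i anc-refl) oy

      hpi : head (parent Tr i) ≡ h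
      hpi = trans same-head hy

      IH = ih opi hpi s≼pi

      covered-pi : covered (parent Tr i) ≡ true
      covered-pi = anyᵇ-intro (λ B → O B (parent Tr i)) I opi

      within-first : toℕ (suc i) ≤ toℕ b → start (suc i) ≡ start s
      within-first le = trans (start-extends i hv covered-pi (≤-trans le (≤-reflexive (sym (trans (cong witnessReach pi-start) reach-s)))))
                              pi-start
        where
        pi-start : start (parent Tr i) ≡ start s
        pi-start = proj₁ IH (≤-trans (<⇒≤ (parent<child i)) le)

      enters-next : toℕ b < toℕ (suc i) → toℕ (parent Tr i) ≤ toℕ b → (start (suc i) ∈ᵇ heavyChildL b) ≡ true
      enters-next b<y pi≤b = subst (λ z → (z ∈ᵇ heavyChildL b) ≡ true) (sym starts-here)
                               (∈ᵇ-enumerate⁺ (λ c → heavy c ∧ childOf Tr c b) (suc i)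
                                 (∧-intro hv (subst (λ z → childOf Tr (suc i) z ≡ true) (sym b≡pi) (childOf-parent i))))
        where
        b≡pi : b ≡ parent Tr i
        b≡pi with no-vertex-between (same-head⇒anc b (parent Tr i) (trans hpi (sym hb)) pi≤b)
                                    (same-head⇒anc (suc i) b (trans hb (sym hy)) (<⇒≤ b<y)) refl
        ... | inj₁ q = q
        ... | inj₂ q = ⊥-elim (<-irrefl (cong toℕ q) b<y)
        starts-here : start (suc i) ≡ suc i
        starts-here with start-cases i
        ... | inj₁ q = q
        ... | inj₂ (_ , _ , le , _) = ⊥-elim (<-irrefl refl (<-≤-trans b<y (≤-trans le
                 (≤-reflexive (trans (cong witnessReach (proj₁ IH (≤-reflexive (cong toℕ (sym b≡pi))))) reach-s)))))

      stays-next : toℕ b < toℕ (parent Tr i) → (start (suc i) ∈ᵇ heavyChildL b) ≡ true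
      stays-next b<pi = subst (λ z → (z ∈ᵇ heavyChildL b) ≡ true) (sym joins-parent) x∈
        where
        x = start (parent Tr i)
        x∈ : (x ∈ᵇ heavyChildL b) ≡ true
        x∈ = proj₂ IH b<pi
        x-head : head x ≡ h
        x-head = trans (proj₁ (start-on-path (parent Tr i))) hpi
        b<x : toℕ b < toℕ x
        b<x with childOf⇒parent {x} {b} (∧-elimʳ {heavy x} (∈ᵇ-enumerate⁻ (λ c → heavy c ∧ childOf Tr c b) x x∈))
        ... | (j , x≡j , pj) = subst (λ z → toℕ b < toℕ z) (sym x≡j) (subst (λ z → toℕ z < suc (toℕ j)) pj (parent<child j))
        ox : O I x ≡ true
        ox = between-in′ I os (same-head⇒anc x s (trans hs (sym x-head)) (≤-trans s≤b (<⇒≤ b<x)))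
                         (proj₂ (start-on-path (parent Tr i))) opi
        joins-parent : start (suc i) ≡ x
        joins-parent = start-extends i hv covered-pi (witnessReach-≥ I x (suc i) ox oy (trans hy (sym x-head)))

      beyond-first : toℕ b < toℕ (suc i) → (start (suc i) ∈ᵇ heavyChildL b) ≡ true
      beyond-first b<y with toℕ (parent Tr i) ≤? toℕ b
      ... | yes pi≤b = enters-next b<y pi≤b
      ... | no pi≰b = stays-next (≰⇒> pi≰b)

    claim : ∀ y → Claim y
    claim = index-induction Claim from-smaller
      where
      from-smaller : ∀ y → (∀ w → toℕ w < toℕ y → Claim w) → Claim y
      from-smaller y ih oy hy sy with y F.≟ s
      ... | yes refl = (λ _ → refl) , (λ lt → ⊥-elim (<-irrefl refl (<-≤-trans lt s≤b)))
      ... | no y≢s with below-head-heavy y (λ q → <-irrefl refl (≤-<-trans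
                          (≤-trans (≤-reflexive (cong toℕ (trans q (trans hy (sym hs))))) (anc⇒≤ (head-anc s)))
                          (anc-≢⇒< sy (λ e → y≢s (sym e)))))
      ...   | (i , refl , hv , same-head) = Step.within-first i (ih (parent Tr i) (parent<child i)) oy hy sy y≢s hv same-head ,
                                            Step.beyond-first i (ih (parent Tr i) (parent<child i)) oy hy sy y≢s hv same-head

  witness-∈-outOnPath : ∀ I p → O I p ≡ true → ∀ B → witnessL (start p) ≡ B ∷ [] → (B ∈ᵇ outOnPath I (head p)) ≡ true
  witness-∈-outOnPath I p op B eB with topOnPathL-spec I p op
  ... | (s , eS , os , hs , s≤p) with witness-covers s I os
  ...   | (B₁ , eB₁ , oB₁) with bottomOn-spec B₁ (head p) s oB₁ hs
  ...     | (b , _ , hb , s≤b , bottomEq , bottomLEq) =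
    ∈ᵇ-concatMap⁺ (witnessesFrom (head p)) (topOnPathL I (head p)) s B (∈ᵇ-≡singleton eS) B∈
    where
    reach-s : witnessReach (start s) ≡ toℕ b
    reach-s = trans (cong (λ L → bottomOfFirst L (head (start s))) eB₁)
                    (trans (cong (bottomOn B₁) (trans (proj₁ (start-on-path s)) hs)) bottomEq)
    claim = SegmentsMet.claim I (head p) s b os hs hb s≤b reach-s p op refl (same-head⇒anc p s hs s≤p)
    B∈ : (B ∈ᵇ witnessesFrom (head p) s) ≡ true
    B∈ with toℕ p ≤? toℕ b
    ... | yes p≤b = ∈ᵇ-++⁺ˡ B (witnessL (start s)) _
                      (∈ᵇ-≡singleton (trans (cong witnessL (sym (proj₁ claim p≤b))) eB))
    ... | no p≰b = ∈ᵇ-++⁺ʳ B (witnessL (start s)) _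
                     (∈ᵇ-concatMap⁺ witnessL (nextStartL (head p) s) (start p) B
                       (∈ᵇ-concatMap⁺ heavyChildL (concatMap (λ B → bottomOnL B (head p)) (witnessL (start s))) b (start p)
                         (∈ᵇ-concatMap⁺ (λ B → bottomOnL B (head p)) (witnessL (start s)) B₁ b
                           (∈ᵇ-≡singleton eB₁) (∈ᵇ-≡singleton bottomLEq))
                         (proj₂ claim (≰⇒> p≰b)))
                       (∈ᵇ-≡singleton eB))

  pathsMet : Fin N → List V
  pathsMet I = concatMap (headsOnPath (top I)) (enumerate (childlessIn (O I)))

  outList : Fin N → List (Fin N)
  outList I = concatMap (outOnPath I) (pathsMet I)

  head-∈-pathsMet : ∀ I p → O I p ≡ true → (head p ∈ᵇ pathsMet I) ≡ true
  head-∈-pathsMet I p op =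
    ∈ᵇ-concatMap⁺ (headsOnPath (top I)) (enumerate (childlessIn (O I))) bottom (head p)
                  (∈ᵇ-enumerate⁺ (childlessIn (O I)) bottom bottom-childless)
                  (head-∈-headsFuel (toℕ bottom) (top I) bottom p ≤-refl (top-anc I p op) bottom-anc)
    where
    open BottomBelow (O I) p op

  witness-∈-outList : ∀ I p → O I p ≡ true → ∀ B → witnessL (start p) ≡ B ∷ [] → (B ∈ᵇ outList I) ≡ true
  witness-∈-outList I p op B eB =
    ∈ᵇ-concatMap⁺ (outOnPath I) (pathsMet I) (head p) B (head-∈-pathsMet I p op) (witness-∈-outOnPath I p op B eB)

  module Bounds (k : ℕ) .{{_ : NonZero k}} (hk : hostLeaves Tr ≤ k) where

    headsOnPath-length : ∀ t a → Anc t a → length (headsOnPath t a) ≤ suc ⌈log₂ k ⌉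
    headsOnPath-length t a ta = ≤-trans (≤-reflexive (sym (⌈log₂2^n⌉≡n len)))
                                 (≤-trans (⌈log₂⌉-mono-≤ 2^len≤2k) (≤-reflexive (⌈log₂2*n⌉≡1+⌈log₂n⌉ k)))
      where
      len = length (headsOnPath t a)
      2^len≤2k : 2 ^ len ≤ 2 * k
      2^len≤2k = begin
        2 ^ len                       ≡⟨ sym (*-identityʳ (2 ^ len)) ⟩
        2 ^ len * 1                   ≤⟨ *-monoʳ-≤ (2 ^ len) (leavesBelow-pos a) ⟩
        2 ^ len * leavesBelow a       ≤⟨ headsFuel-length (toℕ a) t a ≤-refl ta ⟩
        2 * leavesBelow t             ≤⟨ *-monoʳ-≤ 2 (≤-trans (leavesBelow≤total t) (≤-trans childlessInHost≤hostLeaves hk)) ⟩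
        2 * k                         ∎
        where open ≤-Reasoning

    outList-length : ∀ I → length (outList I) ≤ leaves Tr (O I) * suc ⌈log₂ k ⌉ * 2
    outList-length I = ≤-trans (length-concatMap≤ (outOnPath I) (pathsMet I) 2 (outOnPath-length I))
                               (*-monoˡ-≤ 2 (≤-trans paths (*-monoˡ-≤ (suc ⌈log₂ k ⌉) (childless≤leaves (O I)))))
      where
      paths : length (pathsMet I) ≤ count (childlessIn (O I)) * suc ⌈log₂ k ⌉
      paths = ≤-trans (length-concatMap≤′ (headsOnPath (top I)) (enumerate (childlessIn (O I))) (suc ⌈log₂ k ⌉)
                        (λ a p → headsOnPath-length (top I) a
                                   (top-anc I a (∧-elimˡ {O I a} (∈ᵇ-enumerate⁻ (childlessIn (O I)) a p)))))
                      (≤-reflexive (cong (_* suc ⌈log₂ k ⌉) (length-enumerate (childlessIn (O I)))))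

  module Colouring (k ℓ : ℕ) .{{_ : NonZero k}} (hk : hostLeaves Tr ≤ k) (hl : ∀ A → leaves Tr (O A) ≤ ℓ) where

    open Bounds k hk

    d : ℕ
    d = ℓ * suc ⌈log₂ k ⌉ * 2

    graph : List Edge
    graph = outGraph outList

    degenerate : ∀ (H : Fin N → Bool) h → H h ≡ true → ∃ λ A → H A ≡ true × count (λ B → H B ∧ adjacent graph A B) ≤ 2 * d
    degenerate H h hh = let (A , hA , sparse) = low-degree graph H h hh in
      A , hA , *-cancelˡ-≤ (count H) {{>-nonZero (count-pos H h hh)}} (≤-trans sparse (begin
        2 * edgesWithin H graph   ≤⟨ *-monoʳ-≤ 2 (edgesWithin-outGraph outList H d
                                       (λ A → ≤-trans (outList-length A) (*-monoˡ-≤ 2 (*-monoˡ-≤ (suc ⌈log₂ k ⌉) (hl A))))) ⟩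
        2 * (count H * d)         ≡⟨ sym (*-assoc 2 (count H) d) ⟩
        2 * count H * d           ≡⟨ cong (_* d) (*-comm 2 (count H)) ⟩
        count H * 2 * d           ≡⟨ *-assoc (count H) 2 d ⟩
        count H * (2 * d)         ∎))
      where open ≤-Reasoning

    open GreedyColouring (2 * d) (adjacent graph) (adjacent-sym graph) (adjacent-irrefl graph) degenerate

    cf-colouring : ∃ λ (c : Fin N → Fin (suc (2 * d))) → CF O c
    cf-colouring = proj₁ colouring , λ p (i , oi) →
      let (B , eB , oB) = witness-covers p i oi in
      B , oB , λ j oj j≢B →
        proj₂ colouring j B (adjacent-intro graph j≢B (hasEdge-outGraph⁺ outList j B (witness-∈-outList j p oj B eB)))

isqrt : ℕ → ℕ
isqrt zero = 0
isqrt (suc m) = if suc (isqrt m) * suc (isqrt m) ≤ᵇ suc m then suc (isqrt m) else isqrt m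

isqrt-spec : ∀ m → isqrt m * isqrt m ≤ m × m < suc (isqrt m) * suc (isqrt m)
isqrt-spec zero = z≤n , s≤s z≤n
isqrt-spec (suc m) with isqrt-spec m | bool-cases (suc (isqrt m) * suc (isqrt m) ≤ᵇ suc m)
... | (r²≤m , m<r′²) | inj₁ fits rewrite fits =
      ≤ᵇ⇒≤′ fits , <-≤-trans (s≤s m<r′²) (*-mono-< (n<1+n (suc (isqrt m))) (n<1+n (suc (isqrt m))))
... | (r²≤m , m<r′²) | inj₂ too-big rewrite too-big =
      m≤n⇒m≤1+n r²≤m , ≰⇒> (λ le → bool-absurd (≤⇒≤ᵇ′ le) too-big)

m*m≤n*n⇒m≤n : ∀ m n → m * m ≤ n * n → m ≤ n
m*m≤n*n⇒m≤n m n sq with m ≤? n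
... | yes m≤n = m≤n
... | no m≰n = ⊥-elim (<-irrefl refl (<-≤-trans (*-mono-< (≰⇒> m≰n) (≰⇒> m≰n)) sq))

[1+k]²≤24k : ∀ k → 1 ≤ k → k ≤ 15 → suc k * suc k ≤ 24 * k
[1+k]²≤24k k 1≤k k≤15 = begin
  suc k * suc k        ≡⟨ expand k ⟩
  k * k + 2 * k + 1    ≤⟨ +-mono-≤ (+-monoˡ-≤ (2 * k) (*-monoˡ-≤ k k≤15)) 1≤k ⟩
  15 * k + 2 * k + k   ≡⟨ collect k ⟩
  18 * k               ≤⟨ *-monoˡ-≤ k (≤ᵇ⇒≤′ {18} {24} refl) ⟩
  24 * k               ∎
  where
  open ≤-Reasoning
  expand : ∀ k → suc k * suc k ≡ k * k + 2 * k + 1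
  expand = solve-∀
  collect : ∀ k → 15 * k + 2 * k + k ≡ 18 * k
  collect = solve-∀

[3+d]²≤24k : ∀ d k → d * d ≤ 16 * k → 16 ≤ k → (3 + d) * (3 + d) ≤ 24 * k
[3+d]²≤24k d k d²≤16k 16≤k = begin
  (3 + d) * (3 + d)        ≡⟨ expand d ⟩
  d * d + 6 * d + 9        ≤⟨ +-mono-≤ (+-mono-≤ d²≤16k (*-monoʳ-≤ 6 d≤k)) 9≤2k ⟩
  16 * k + 6 * k + 2 * k   ≡⟨ collect k ⟩
  24 * k                   ∎
  where
  open ≤-Reasoning
  expand : ∀ d → (3 + d) * (3 + d) ≡ d * d + 6 * d + 9
  expand = solve-∀
  collect : ∀ k → 16 * k + 6 * k + 2 * k ≡ 24 * k
  collect = solve-∀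
  d≤k : d ≤ k
  d≤k = m*m≤n*n⇒m≤n d k (≤-trans d²≤16k (*-monoˡ-≤ k 16≤k))
  9≤2k : 9 ≤ 2 * k
  9≤2k = ≤-trans (≤ᵇ⇒≤′ {9} {16} refl) (≤-trans 16≤k (m≤m+n k (k + 0)))

1+4ℓ[1+L]≤9ℓL : ∀ ℓ L → 1 ≤ ℓ → 1 ≤ L → suc (2 * (ℓ * suc L * 2)) ≤ 9 * ℓ * L
1+4ℓ[1+L]≤9ℓL ℓ L 1≤ℓ 1≤L = begin
  suc (2 * (ℓ * suc L * 2))           ≡⟨ expand ℓ L ⟩
  1 + 4 * ℓ + 4 * (ℓ * L)             ≤⟨ +-monoˡ-≤ (4 * (ℓ * L)) (+-mono-≤ (≤-trans 1≤ℓ ℓ≤ℓL) (*-monoʳ-≤ 4 ℓ≤ℓL)) ⟩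
  ℓ * L + 4 * (ℓ * L) + 4 * (ℓ * L)   ≡⟨ collect ℓ L ⟩
  9 * ℓ * L                           ∎
  where
  open ≤-Reasoning
  ℓ≤ℓL : ℓ ≤ ℓ * L
  ℓ≤ℓL = ≤-trans (≤-reflexive (sym (*-identityʳ ℓ))) (*-monoʳ-≤ ℓ 1≤L)
  expand : ∀ ℓ L → suc (2 * (ℓ * suc L * 2)) ≡ 1 + 4 * ℓ + 4 * (ℓ * L)
  expand = solve-∀
  collect : ∀ ℓ L → ℓ * L + 4 * (ℓ * L) + 4 * (ℓ * L) ≡ 9 * ℓ * L
  collect = solve-∀

nm-colouring-by-leaves : ∀ {n N} (T : TreeSpace n) (O : Fin N → Subset n) (D : ℕ) →
  (∀ i → Connected T (O i)) → (∀ i → count (RootedTree.childlessIn T (O i)) ≤ D) →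
  ∃ λ (c : Fin N → Fin (suc D)) → NM O c
nm-colouring-by-leaves T O D CO few-leaves = c , λ p (i , j , i≢j , oi , oj) →
  let (A , B , _ , _ , oA , oB , ne) = nm p i j i≢j refl refl oi oj in A , B , oA , oB , ne
  where
  open LeafPointers.Degenerate T O CO (λ _ → true) D (λ A _ → few-leaves A) renaming (nm-colouring to col)
  c = proj₁ col
  nm = proj₂ col

nm-bound : (k ℓ n N : ℕ) (T : TreeSpace n) (O : Fin N → Subset n) →
  hostLeaves T ≤ k → ValidFamily T ℓ O →
  ∃[ q ] (q ≤ ℓ + 1 × q * q ≤ 24 * k × ∃[ c ] NM {q = q} O c)
nm-bound k ℓ n N T O hk valid = by-size (suc D * suc D ≤? 24 * k)
  where
  open RootedTree T
  D = ℓ ⊓ k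
  CO = λ i → proj₁ (valid i)
  1+D≤ℓ+1 : suc D ≤ ℓ + 1
  1+D≤ℓ+1 = ≤-trans (s≤s (m⊓n≤m ℓ k)) (≤-reflexive (+-comm 1 ℓ))
  few-leaves : ∀ i → count (childlessIn (O i)) ≤ D
  few-leaves i = ⊓-glb (≤-trans (childless≤leaves (O i)) (proj₂ (valid i)))
                       (≤-trans (Subtree.childless≤childlessInHost (O i) (CO i)) (≤-trans childlessInHost≤hostLeaves hk))
  by-size : Dec (suc D * suc D ≤ 24 * k) → ∃[ q ] (q ≤ ℓ + 1 × q * q ≤ 24 * k × ∃[ c ] NM {q = q} O c)
  by-size (yes small) = suc D , 1+D≤ℓ+1 , small , nm-colouring-by-leaves T O D CO few-leaves
  by-size (no large) = 3 + δ , ≤-trans (m*m≤n*n⇒m≤n (3 + δ) (suc D) (≤-trans square (<⇒≤ (≰⇒> large)))) 1+D≤ℓ+1 ,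
                       square , SpecialGraph.Colouring.nm-colouring T O CO k δ hk fits
    where
    δ = isqrt (16 * k)
    fits : 16 * k < suc δ * suc (suc δ)
    fits = <-≤-trans (proj₂ (isqrt-spec (16 * k))) (*-monoʳ-≤ (suc δ) (n≤1+n (suc δ)))
    16≤k : 16 ≤ k
    16≤k with 16 ≤? k
    ... | yes 16≤k = 16≤k
    ... | no 16≰k = ⊥-elim (large (≤-trans (*-mono-≤ (s≤s (m⊓n≤n ℓ k)) (s≤s (m⊓n≤n ℓ k)))
                                    ([1+k]²≤24k k (≤-trans childlessInHost-pos (≤-trans childlessInHost≤hostLeaves hk))
                                                  (≤-pred (≰⇒> 16≰k)))))
    square : (3 + δ) * (3 + δ) ≤ 24 * k
    square = [3+d]²≤24k δ k (proj₁ (isqrt-spec (16 * k))) 16≤k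

cf-bound : ∃[ C ] ((k ℓ n N : ℕ) (T : TreeSpace n) (O : Fin N → Subset n) →
  2 ≤ k → 1 ≤ ℓ → hostLeaves T ≤ k → ValidFamily T ℓ O →
  ∃[ q ] (q ≤ C * ℓ * ⌈log₂ k ⌉ × ∃[ c ] CF {q = q} O c))
cf-bound = 9 , bound
  where
  bound : (k ℓ n N : ℕ) (T : TreeSpace n) (O : Fin N → Subset n) →
    2 ≤ k → 1 ≤ ℓ → hostLeaves T ≤ k → ValidFamily T ℓ O →
    ∃[ q ] (q ≤ 9 * ℓ * ⌈log₂ k ⌉ × ∃[ c ] CF {q = q} O c)
  bound (suc zero) ℓ n N T O (s≤s ())
  bound k@(suc (suc _)) ℓ n N T O _ 1≤ℓ hk valid =
    suc (2 * d) , 1+4ℓ[1+L]≤9ℓL ℓ ⌈log₂ k ⌉ 1≤ℓ 1≤log₂k , cf-colouring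
    where
    open CFColouring.Colouring T O (λ i → proj₁ (valid i)) k ℓ hk (λ i → proj₂ (valid i))
    1≤log₂k : 1 ≤ ⌈log₂ k ⌉
    1≤log₂k = ≤-trans (≤-reflexive (sym (⌈log₂2^n⌉≡n 1))) (⌈log₂⌉-mono-≤ {2} {k} (s≤s (s≤s z≤n)))

theorem1 : ((k ℓ n N : ℕ) (T : TreeSpace n) (O : Fin N → Subset n) →
      hostLeaves T ≤ k → ValidFamily T ℓ O →
      ∃[ q ] (q ≤ ℓ + 1 × q * q ≤ 24 * k × ∃[ c ] NM {q = q} O c))
    ×
    (∃[ C ] ((k ℓ n N : ℕ) (T : TreeSpace n) (O : Fin N → Subset n) →
      2 ≤ k → 1 ≤ ℓ → hostLeaves T ≤ k → ValidFamily T ℓ O →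
      ∃[ q ] (q ≤ C * ℓ * ⌈log₂ k ⌉ × ∃[ c ] CF {q = q} O c)))
theorem1 = nm-bound , cf-bound
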